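{- Let $1\le j\le k\le n-2$ be integers with $k-j$ odd, let $d=(k-j+1)/2$, let $t=(t_j,\dots,t_k)\in(\mathbb{F}_q^\times)^{2d}$, and set $\lambda_t=\sum_{i=j}^k t_ie_{i,i+2}^*\in\mathfrak{u}_n(\mathbb{F}_q)^*$. Then: (1) There exist $a_1,\dots,a_d\in\mathbb{F}_q^\times$, determined by $t$, such that the coadjoint orbit of $\lambda_t$ is \[\Big\{\lambda_t+\sum_{i=0}^{2d}u_ie^*_{i+j,i+j+1}:u_1,\dots,u_{2d}\in\mathbb{F}_q,\ u_0=\sum_{i=1}^d a_iu_{2i}\Big\}.\] (2) The coadjoint orbits of the functionals $\lambda_t+ue_{j,j+1}^*$ for $u\in\mathbb{F}_q$ are pairwise disjoint. (3) With $\gamma=e_{j,j+1}^*+e_{j+1,j+2}^*+\dots+e_{k,k+1}^*+e_{k+1,k+2}^*$, the number of $t\in(\mathbb{F}_q^\times)^{2d}$ such that $\lambda_t+\gamma$ belongs to the coadjoint orbit of $\lambda_t$ is $\frac1q\big((q-1)^{2d}-(-1)^d(q-1)^d\big)$.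
   Context: $\mathfrak{u}_n(\mathbb{F}_q)$ is the algebra of strictly upper triangular $n\times n$ matrices over $\mathbb{F}_q$, $\mathbf U_n(\mathbb F_q)=1+\mathfrak u_n(\mathbb F_q)$, and $e_{ij}^*\in\mathfrak{u}_n(\mathbb{F}_q)^*$ is the functional $X\mapsto X_{ij}$ for $1\le i<j\le n$. The coadjoint orbit of $\lambda\in\mathfrak u_n(\mathbb F_q)^*$ is $\{g\lambda g^{ -1}:g\in\mathbf U_n(\mathbb F_q)\}$, where $(g\lambda h)(X)=\lambda(g^{ -1}Xh^{ -1})$. -}

module Defs where

open import Level using (Level; _⊔_)
open import Data.Nat as ℕ using (ℕ; zero; suc; _∸_; _≡ᵇ_; _<ᵇ_; _≤ᵇ_)
open import Data.Bool using (Bool; true; false; if_then_else_; _∧_)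
open import Data.Fin using (Fin)
open import Data.Vec using (Vec; []; _∷_)
open import Data.Product using (Σ; ∃; ∃-syntax; _×_; _,_)
open import Relation.Nullary using (¬_)
open import Relation.Binary.PropositionalEquality using (_≡_)
open import Function.Bundles using (_⤖_)
open import Algebra.Bundles using (CommutativeRing)

record FiniteField (c ℓ : Level) : Set (Level.suc (c ⊔ ℓ)) where
  field
    commRing : CommutativeRing c ℓ
  open CommutativeRing commRing public
  field
    ≈⇒≡      : ∀ {x y} → x ≈ y → x ≡ y
    1≉0      : ¬ (1# ≈ 0#)
    inverse  : ∀ x → ¬ (x ≈ 0#) → ∃[ y ] (x * y ≈ 1#)
    q        : ℕ
    enum     : Fin q ⤖ Carrier

-- Linear algebra over F with 1-based natural-number indices 1..n.

module LinAlg {c ℓ} (F : FiniteField c ℓ) where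
  open FiniteField F hiding (Carrier; _≈_; q)
  open FiniteField F public using (Carrier; _≈_; q) renaming (_*_ to _*F_)

  sumR : ℕ → (ℕ → Carrier) → Carrier
  sumR zero    f = 0#
  sumR (suc m) f = sumR m f + f m

  sum1 : ℕ → (ℕ → Carrier) → Carrier
  sum1 n f = sumR n (λ i → f (suc i))

  -- entry m (0-based) of a vector, 0 outside the range
  get : ∀ {m} → Vec Carrier m → ℕ → Carrier
  get []       _       = 0#
  get (x ∷ xs) zero    = x
  get (x ∷ xs) (suc i) = get xs i

  -- n×n matrices: entries (i , j) for 1 ≤ i , j ≤ n (others ignored)
  Mat : Set c
  Mat = ℕ → ℕ → Carrier

  mul : ℕ → Mat → Mat → Mat
  mul n A B i j = sum1 n (λ l → A i l * B l j)

  idM : Mat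
  idM i j = if i ≡ᵇ j then 1# else 0#

  MatEq : ℕ → Mat → Mat → Set ℓ
  MatEq n A B = ∀ i j → 1 ℕ.≤ i → i ℕ.≤ n → 1 ℕ.≤ j → j ℕ.≤ n → A i j ≈ B i j

  IsStrictUpper : ℕ → Mat → Set ℓ
  IsStrictUpper n X = ∀ i j → 1 ℕ.≤ i → i ℕ.≤ n → 1 ℕ.≤ j → j ℕ.≤ n → j ℕ.≤ i → X i j ≈ 0#

  IsUnitriangular : ℕ → Mat → Set ℓ
  IsUnitriangular n g =
    (∀ i → 1 ℕ.≤ i → i ℕ.≤ n → g i i ≈ 1#) ×
    (∀ i j → 1 ℕ.≤ i → i ℕ.≤ n → 1 ℕ.≤ j → j ℕ.≤ n → j ℕ.< i → g i j ≈ 0#)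

  -- Elements of 𝔲_n(F_q)^*, written in the dual basis e*_{ij} (i < j):
  -- λ = Σ_{i<j} λ i j e*_{ij}.
  Fun : Set c
  Fun = ℕ → ℕ → Carrier

  ev : ℕ → Fun → Mat → Carrier
  ev n φ X = sum1 n (λ i → sum1 n (λ j → if i <ᵇ j then φ i j * X i j else 0#))

  FunEq : ℕ → Fun → Fun → Set (c ⊔ ℓ)
  FunEq n φ ψ = ∀ X → IsStrictUpper n X → ev n φ X ≈ ev n ψ X

  e* : ℕ → ℕ → Fun
  e* a b i j = if (a ≡ᵇ i) ∧ (b ≡ᵇ j) then 1# else 0#

  _⊕_ : Fun → Fun → Fun
  (φ ⊕ ψ) i j = φ i j + ψ i j

  _·_ : Carrier → Fun → Fun
  (s · φ) i j = s * φ i j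

  sumFun : ℕ → (ℕ → Fun) → Fun
  sumFun m φ a b = sumR m (λ i → φ i a b)

  -- coadjoint orbit: μ ∈ Orbit n λ iff μ = g λ g⁻¹ for some g ∈ U_n,
  -- where (g λ g⁻¹)(X) = λ(g⁻¹ X g).
  InOrbit : ℕ → Fun → Fun → Set (c ⊔ ℓ)
  InOrbit n φ μ = ∃[ g ] ∃[ h ]
    (IsUnitriangular n g × MatEq n (mul n g h) idM × MatEq n (mul n h g) idM ×
     (∀ X → IsStrictUpper n X → ev n μ X ≈ ev n φ (mul n (mul n h X) g)))

  Nonzero : Carrier → Set ℓ
  Nonzero x = ¬ (x ≈ 0#)

  -- λ_t = Σ_{i=j}^{k} t_i e*_{i,i+2}, where t = (t_j,…,t_k) is stored as a
  -- vector with t_i at position i - j.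
  lamT : ∀ {m} → ℕ → ℕ → Vec Carrier m → Fun
  lamT j k t = sumFun (suc (k ∸ j)) (λ r → get t r · e* (j ℕ.+ r) (j ℕ.+ r ℕ.+ 2))

  gamma : ℕ → ℕ → Fun
  gamma j k = sumFun (suc (suc (k ∸ j))) (λ r → e* (j ℕ.+ r) (j ℕ.+ r ℕ.+ 1))

  -- Σ_{i=0}^{2d} u_i e*_{i+j,i+j+1}, with u_0 given separately and
  -- u = (u_1,…,u_{2d}) stored with u_i at position i - 1.
  uSum : ∀ {m} → ℕ → Carrier → Vec Carrier m → Fun
  uSum {m} j u0 u = sumFun (suc m)
    (λ i → (if i ≡ᵇ 0 then u0 else get u (i ∸ 1)) · e* (i ℕ.+ j) (i ℕ.+ j ℕ.+ 1))

-- Conjugating λ_t by a unitriangular g only moves it along the superdiagonal band: with x the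
-- superdiagonal of g, the coefficient of e*_{j+i,j+i+1} becomes u_i = t_i x_{i+1} - t_{i-1} x_{i-1}.
-- Because t_{k+1} = 0, the values u_0, …, u_{2d} satisfy exactly one linear relation, found by
-- telescoping u_2, u_4, …, u_{2d} against weights a_p: u_0 = Σ a_p u_{2p}. Conversely every u satisfying
-- it is reached by a bidiagonal g whose superdiagonal is solved for recursively; this gives (1).
-- The relation makes u_0 - Σ a_p u_{2p} an orbit invariant, which gives (2). For λ_t + γ all u_i are 1,
-- so (3) asks for Σ a_p = 1, i.e. for the continued fraction H_d(t) = 1 + (t_0/t_1)(1 + (t_2/t_3)(⋯)) to
-- vanish; its zero count Z_d satisfies Z_{d+1} = (q-1)((q-1)^{2d} - Z_d), whose solution is the formula.

module Submission where

open import Defs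
open import Data.Nat as ℕ using (ℕ; zero; suc; z≤n; s≤s; _≡ᵇ_; _<ᵇ_; _∸_)
import Data.Nat.Properties as ℕP
open import Data.Bool using (Bool; true; false; if_then_else_; not) renaming (T to IsTrue)
open import Data.Unit using (tt)
open import Data.Empty using (⊥-elim)
open import Data.Fin.Properties using (inj⇒≟)
open import Data.Sum using (_⊎_; inj₁; inj₂)
open import Data.Vec using (Vec; []; _∷_)
import Data.Vec.Properties as VecP
open import Data.Vec.Relation.Unary.All using (All; []; _∷_)
open import Data.List using (List; []; _∷_; map; _++_; length; filter; cartesianProductWith; allFin)
import Data.List.Properties as ListP
open import Data.List.Relation.Unary.Any using (here; there)
import Data.List.Relation.Unary.All as ListAll
open import Data.List.Relation.Unary.AllPairs using ([]; _∷_)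
open import Data.List.Relation.Unary.Unique.Propositional using (Unique)
import Data.List.Relation.Unary.Unique.Propositional.Properties as UniqueP
open import Data.List.Membership.Propositional using (_∈_; _∉_)
import Data.List.Membership.Propositional.Properties as ∈P
open import Function.Bundles using (Bijection; _⇔_; mk⇔)
open import Data.Product using (Σ-syntax; _×_; _,_; proj₁; proj₂)
open import Function.Properties.Bijection using (⤖⇒↔)
open import Function.Properties.Inverse using (↔-sym; ↔⇒↣)
open import Relation.Nullary using (¬_; Dec; yes; no; does; ¬?)
open import Relation.Nullary.Decidable using (dec-true; dec-false)
open import Relation.Binary.Definitions using (tri<; tri≈; tri>)
open import Relation.Binary.PropositionalEquality
  using (_≡_; _≢_; refl; sym; trans; cong; cong₂; subst; module ≡-Reasoning)
import Algebra.Properties.Ring as RingProperties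
import Algebra.Properties.CommutativeSemigroup as CommutativeSemigroupProperties
import Algebra.Solver.Ring.NaturalCoefficients as NaturalCoefficientsSolver
open import Data.Maybe using (nothing)
open import Data.Integer as ℤ using (-1ℤ; 1ℤ)
import Data.Integer.Properties as ℤP
open import Data.Integer.Tactic.RingSolver using (solve-∀)

¬T⇒≡false : ∀ {b} → ¬ IsTrue b → b ≡ false
¬T⇒≡false {false} _ = refl
¬T⇒≡false {true}  ¬T = ⊥-elim (¬T tt)

T⇒≡true : ∀ {b} → IsTrue b → b ≡ true
T⇒≡true {true} _ = refl

≡ᵇ-refl : ∀ m → (m ≡ᵇ m) ≡ true
≡ᵇ-refl m = T⇒≡true (ℕP.≡⇒≡ᵇ m m refl)

≡ᵇ-false : ∀ {m n} → m ≢ n → (m ≡ᵇ n) ≡ false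
≡ᵇ-false {m} {n} m≢n = ¬T⇒≡false (λ t → m≢n (ℕP.≡ᵇ⇒≡ m n t))

<ᵇ-true : ∀ {m n} → m ℕ.< n → (m <ᵇ n) ≡ true
<ᵇ-true m<n = T⇒≡true (ℕP.<⇒<ᵇ m<n)

<ᵇ-false : ∀ {m n} → ¬ (m ℕ.< n) → (m <ᵇ n) ≡ false
<ᵇ-false {m} {n} m≮n = ¬T⇒≡false (λ t → m≮n (ℕP.<ᵇ⇒< m n t))

module FieldFacts {c ℓ} (F : FiniteField c ℓ) where
  private
    module R = FiniteField F
    module RP = RingProperties R.ring
  open R public using (Carrier; _+_; _*_; -_; 0#; 1#; _≈_; ≈⇒≡)
  open ≡-Reasoning

  -- ≈ coincides with ≡ (≈⇒≡), so the ring laws are restated for ≡, where cong and rewrite are available.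
  ≡⇒≈ : ∀ {x y} → x ≡ y → x ≈ y
  ≡⇒≈ = R.reflexive

  +-comm : ∀ x y → x + y ≡ y + x
  +-comm x y = ≈⇒≡ (R.+-comm x y)
  +-assoc : ∀ x y z → (x + y) + z ≡ x + (y + z)
  +-assoc x y z = ≈⇒≡ (R.+-assoc x y z)
  *-comm : ∀ x y → x * y ≡ y * x
  *-comm x y = ≈⇒≡ (R.*-comm x y)
  *-assoc : ∀ x y z → (x * y) * z ≡ x * (y * z)
  *-assoc x y z = ≈⇒≡ (R.*-assoc x y z)
  *-distribˡ-+ : ∀ x y z → x * (y + z) ≡ x * y + x * z
  *-distribˡ-+ x y z = ≈⇒≡ (R.distribˡ x y z)
  *-distribʳ-+ : ∀ x y z → (y + z) * x ≡ y * x + z * x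
  *-distribʳ-+ x y z = ≈⇒≡ (R.distribʳ x y z)
  +-identityˡ : ∀ x → 0# + x ≡ x
  +-identityˡ x = ≈⇒≡ (R.+-identityˡ x)
  +-identityʳ : ∀ x → x + 0# ≡ x
  +-identityʳ x = ≈⇒≡ (R.+-identityʳ x)
  *-identityˡ : ∀ x → 1# * x ≡ x
  *-identityˡ x = ≈⇒≡ (R.*-identityˡ x)
  *-identityʳ : ∀ x → x * 1# ≡ x
  *-identityʳ x = ≈⇒≡ (R.*-identityʳ x)
  zeroˡ : ∀ x → 0# * x ≡ 0#
  zeroˡ x = ≈⇒≡ (R.zeroˡ x)
  zeroʳ : ∀ x → x * 0# ≡ 0#
  zeroʳ x = ≈⇒≡ (R.zeroʳ x)
  -‿inverseˡ : ∀ x → - x + x ≡ 0#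
  -‿inverseˡ x = ≈⇒≡ (R.-‿inverseˡ x)
  -‿inverseʳ : ∀ x → x + - x ≡ 0#
  -‿inverseʳ x = ≈⇒≡ (R.-‿inverseʳ x)
  -‿involutive : ∀ x → - (- x) ≡ x
  -‿involutive x = ≈⇒≡ (RP.-‿involutive x)
  -0#≡0# : - 0# ≡ 0#
  -0#≡0# = ≈⇒≡ RP.-0#≈0#
  -‿distribˡ-* : ∀ x y → - x * y ≡ - (x * y)
  -‿distribˡ-* x y = sym (≈⇒≡ (RP.-‿distribˡ-* x y))
  -‿distribʳ-* : ∀ x y → x * - y ≡ - (x * y)
  -‿distribʳ-* x y = sym (≈⇒≡ (RP.-‿distribʳ-* x y))
  +-cancelˡ : ∀ x y z → x + y ≡ x + z → y ≡ z
  +-cancelˡ x y z p = ≈⇒≡ (RP.+-cancelˡ x y z (≡⇒≈ p))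
  +-cancelʳ : ∀ x y z → y + x ≡ z + x → y ≡ z
  +-cancelʳ x y z p = ≈⇒≡ (RP.+-cancelʳ x y z (≡⇒≈ p))
  +-inverseˡ-unique : ∀ x y → x + y ≡ 0# → x ≡ - y
  +-inverseˡ-unique x y p = ≈⇒≡ (RP.+-inverseˡ-unique x y (≡⇒≈ p))

  +-interchange : ∀ w x y z → (w + x) + (y + z) ≡ (w + y) + (x + z)
  +-interchange w x y z = ≈⇒≡ (CommutativeSemigroupProperties.interchange R.+-commutativeSemigroup w x y z)

  1≢0 : 1# ≢ 0#
  1≢0 p = R.1≉0 (≡⇒≈ p)

  _≟_ : (x y : Carrier) → Dec (x ≡ y)
  _≟_ = inj⇒≟ (↔⇒↣ (↔-sym (⤖⇒↔ R.enum)))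

  -- inv 0# = 0#, which keeps inv total.
  inv : Carrier → Carrier
  inv x with x ≟ 0#
  ... | yes _ = 0#
  ... | no x≢0 = proj₁ (R.inverse x (λ x≈0 → x≢0 (≈⇒≡ x≈0)))

  inverseʳ : ∀ x → x ≢ 0# → x * inv x ≡ 1#
  inverseʳ x x≢0 with x ≟ 0#
  ... | yes x≡0 = ⊥-elim (x≢0 x≡0)
  ... | no x≢0′ = ≈⇒≡ (proj₂ (R.inverse x (λ x≈0 → x≢0′ (≈⇒≡ x≈0))))
  inverseˡ : ∀ x → x ≢ 0# → inv x * x ≡ 1#
  inverseˡ x x≢0 = trans (*-comm (inv x) x) (inverseʳ x x≢0)

  *-cancelˡ : ∀ a x y → a ≢ 0# → a * x ≡ a * y → x ≡ y
  *-cancelˡ a x y a≢0 p = begin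
    x                 ≡⟨ sym (*-identityˡ x) ⟩
    1# * x            ≡⟨ cong (_* x) (sym (inverseˡ a a≢0)) ⟩
    (inv a * a) * x   ≡⟨ *-assoc (inv a) a x ⟩
    inv a * (a * x)   ≡⟨ cong (inv a *_) p ⟩
    inv a * (a * y)   ≡⟨ sym (*-assoc (inv a) a y) ⟩
    (inv a * a) * y   ≡⟨ cong (_* y) (inverseˡ a a≢0) ⟩
    1# * y            ≡⟨ *-identityˡ y ⟩
    y                 ∎
  *-inverse-cancelʳ : ∀ x y → y ≢ 0# → (x * inv y) * y ≡ x
  *-inverse-cancelʳ x y y≢0 =
    trans (*-assoc x (inv y) y) (trans (cong (x *_) (inverseˡ y y≢0)) (*-identityʳ x))

  *-nonzero : ∀ x y → x ≢ 0# → y ≢ 0# → x * y ≢ 0#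
  *-nonzero x y x≢0 y≢0 xy≡0 = y≢0 (*-cancelˡ x y 0# x≢0 (trans xy≡0 (sym (zeroʳ x))))
  inv-nonzero : ∀ x → x ≢ 0# → inv x ≢ 0#
  inv-nonzero x x≢0 p = 1≢0 (trans (sym (inverseʳ x x≢0)) (trans (cong (x *_) p) (zeroʳ x)))
  -‿nonzero : ∀ x → x ≢ 0# → - x ≢ 0#
  -‿nonzero x x≢0 p = x≢0 (trans (sym (-‿involutive x)) (trans (cong -_ p) -0#≡0#))

module Sums {c ℓ} (F : FiniteField c ℓ) where
  open FieldFacts F
  open LinAlg F using (sumR)
  open ≡-Reasoning

  sumR-cong : ∀ n {f g : ℕ → Carrier} → (∀ i → i ℕ.< n → f i ≡ g i) → sumR n f ≡ sumR n g
  sumR-cong zero    f≗g = refl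
  sumR-cong (suc n) f≗g = cong₂ _+_ (sumR-cong n (λ i i<n → f≗g i (ℕP.m<n⇒m<1+n i<n))) (f≗g n ℕP.≤-refl)

  sumR-zero : ∀ n (f : ℕ → Carrier) → (∀ i → i ℕ.< n → f i ≡ 0#) → sumR n f ≡ 0#
  sumR-zero zero    f f≗0 = refl
  sumR-zero (suc n) f f≗0 =
    trans (cong₂ _+_ (sumR-zero n f (λ i i<n → f≗0 i (ℕP.m<n⇒m<1+n i<n))) (f≗0 n ℕP.≤-refl)) (+-identityʳ 0#)

  sumR-+ : ∀ n (f g : ℕ → Carrier) → sumR n (λ i → f i + g i) ≡ sumR n f + sumR n g
  sumR-+ zero    f g = sym (+-identityʳ 0#)
  sumR-+ (suc n) f g = trans (cong (_+ (f n + g n)) (sumR-+ n f g)) (+-interchange _ _ _ _)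

  sumR-*ˡ : ∀ n a (f : ℕ → Carrier) → sumR n (λ i → a * f i) ≡ a * sumR n f
  sumR-*ˡ zero    a f = sym (zeroʳ a)
  sumR-*ˡ (suc n) a f = trans (cong (_+ (a * f n)) (sumR-*ˡ n a f)) (sym (*-distribˡ-+ a _ _))

  sumR-*ʳ : ∀ n a (f : ℕ → Carrier) → sumR n (λ i → f i * a) ≡ sumR n f * a
  sumR-*ʳ zero    a f = sym (zeroˡ a)
  sumR-*ʳ (suc n) a f = trans (cong (_+ (f n * a)) (sumR-*ʳ n a f)) (sym (*-distribʳ-+ a _ _))

  sumR-single : ∀ n a (f : ℕ → Carrier) → a ℕ.< n → (∀ i → i ℕ.< n → i ≢ a → f i ≡ 0#) →
                sumR n f ≡ f a
  sumR-single (suc n) a f a<1+n f≗0 with a ℕ.≟ n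
  ... | yes refl =
    trans (cong (_+ f a) (sumR-zero n f (λ i i<n → f≗0 i (ℕP.m<n⇒m<1+n i<n) (λ i≡a → ℕP.<-irrefl i≡a i<n))))
          (+-identityˡ (f a))
  ... | no a≢n =
    trans (cong₂ _+_ (sumR-single n a f (ℕP.≤∧≢⇒< (ℕP.≤-pred a<1+n) a≢n) (λ i i<n → f≗0 i (ℕP.m<n⇒m<1+n i<n)))
                     (f≗0 n ℕP.≤-refl (λ n≡a → a≢n (sym n≡a))))
          (+-identityʳ (f a))

  sumR-pair : ∀ n a (f : ℕ → Carrier) → suc a ℕ.< n → (∀ i → i ℕ.< n → i ≢ a → i ≢ suc a → f i ≡ 0#) →
              sumR n f ≡ f a + f (suc a)
  sumR-pair (suc n) a f 1+a<1+n f≗0 with suc a ℕ.≟ n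
  ... | yes refl = cong (_+ f (suc a)) (sumR-single n a f ℕP.≤-refl
                     (λ i i<n i≢a → f≗0 i (ℕP.m<n⇒m<1+n i<n) i≢a (λ i≡1+a → ℕP.<-irrefl i≡1+a i<n)))
  ... | no 1+a≢n =
    trans (cong₂ _+_ (sumR-pair n a f (ℕP.≤∧≢⇒< (ℕP.≤-pred 1+a<1+n) 1+a≢n) (λ i i<n → f≗0 i (ℕP.m<n⇒m<1+n i<n)))
                     (f≗0 n ℕP.≤-refl (λ n≡a → ℕP.<-irrefl (sym n≡a) (ℕP.≤-pred 1+a<1+n)) (λ n≡1+a → 1+a≢n (sym n≡1+a))))
          (+-identityʳ _)

  sumR-swap : ∀ n m (f : ℕ → ℕ → Carrier) →
              sumR n (λ i → sumR m (λ r → f i r)) ≡ sumR m (λ r → sumR n (λ i → f i r))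
  sumR-swap zero    m f = sym (sumR-zero m (λ _ → 0#) (λ _ _ → refl))
  sumR-swap (suc n) m f = trans (cong (_+ sumR m (f n)) (sumR-swap n m f))
                                (sym (sumR-+ m (λ r → sumR n (λ i → f i r)) (f n)))

  sumR-unfoldˡ : ∀ n (f : ℕ → Carrier) → sumR (suc n) f ≡ f 0 + sumR n (λ i → f (suc i))
  sumR-unfoldˡ zero    f = trans (+-identityˡ (f 0)) (sym (+-identityʳ (f 0)))
  sumR-unfoldˡ (suc n) f = trans (cong (_+ f (suc n)) (sumR-unfoldˡ n f)) (+-assoc _ _ _)

module Functionals {c ℓ} (F : FiniteField c ℓ) where
  open FieldFacts F
  open Sums F
  open LinAlg F using (sumR; sum1; ev; e*; _⊕_; _·_; sumFun; IsStrictUpper; Fun; Mat)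
  open ≡-Reasoning

  private
    term : Fun → Mat → ℕ → ℕ → Carrier
    term φ X i j = if i <ᵇ j then φ i j * X i j else 0#

  e*-off : ∀ a b i j → ¬ (a ≡ i × b ≡ j) → e* a b i j ≡ 0#
  e*-off a b i j ¬a,b≡i,j with a ≡ᵇ i in a≡ᵇi
  ... | false = refl
  ... | true with b ≡ᵇ j in b≡ᵇj
  ...   | false = refl
  ...   | true  = ⊥-elim (¬a,b≡i,j ( ℕP.≡ᵇ⇒≡ a i (subst IsTrue (sym a≡ᵇi) tt)
                                   , ℕP.≡ᵇ⇒≡ b j (subst IsTrue (sym b≡ᵇj) tt)))

  e*-on : ∀ a b → e* a b a b ≡ 1#
  e*-on a b rewrite ≡ᵇ-refl a | ≡ᵇ-refl b = refl

  e*-strictUpper : ∀ n a b → a ℕ.< b → IsStrictUpper n (e* a b)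
  e*-strictUpper n a b a<b i j _ _ _ _ j≤i =
    ≡⇒≈ (e*-off a b i j λ { (refl , refl) → ℕP.<-irrefl refl (ℕP.<-≤-trans a<b j≤i) })

  ev-⊕ : ∀ n φ ψ X → ev n (φ ⊕ ψ) X ≡ ev n φ X + ev n ψ X
  ev-⊕ n φ ψ X = begin
      ev n (φ ⊕ ψ) X
    ≡⟨ sumR-cong n (λ i _ → sumR-cong n (λ j _ → term-⊕ (suc i) (suc j))) ⟩
      sumR n (λ i → sumR n (λ j → term φ X (suc i) (suc j) + term ψ X (suc i) (suc j)))
    ≡⟨ sumR-cong n (λ i _ → sumR-+ n _ _) ⟩
      sumR n (λ i → sum1 n (term φ X (suc i)) + sum1 n (term ψ X (suc i)))
    ≡⟨ sumR-+ n _ _ ⟩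
      ev n φ X + ev n ψ X ∎
    where
    term-⊕ : ∀ i j → term (φ ⊕ ψ) X i j ≡ term φ X i j + term ψ X i j
    term-⊕ i j with i <ᵇ j
    ... | false = sym (+-identityʳ 0#)
    ... | true  = *-distribʳ-+ (X i j) (φ i j) (ψ i j)

  ev-· : ∀ n s φ X → ev n (s · φ) X ≡ s * ev n φ X
  ev-· n s φ X = begin
      ev n (s · φ) X
    ≡⟨ sumR-cong n (λ i _ → sumR-cong n (λ j _ → term-· (suc i) (suc j))) ⟩
      sumR n (λ i → sumR n (λ j → s * term φ X (suc i) (suc j)))
    ≡⟨ sumR-cong n (λ i _ → sumR-*ˡ n s _) ⟩
      sumR n (λ i → s * sum1 n (term φ X (suc i)))
    ≡⟨ sumR-*ˡ n s _ ⟩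
      s * ev n φ X ∎
    where
    term-· : ∀ i j → term (s · φ) X i j ≡ s * term φ X i j
    term-· i j with i <ᵇ j
    ... | false = sym (zeroʳ s)
    ... | true  = *-assoc s (φ i j) (X i j)

  ev-sumFun : ∀ n m φ X → ev n (sumFun m φ) X ≡ sumR m (λ r → ev n (φ r) X)
  ev-sumFun n m φ X = begin
      ev n (sumFun m φ) X
    ≡⟨ sumR-cong n (λ i _ → sumR-cong n (λ j _ → term-sumFun (suc i) (suc j))) ⟩
      sumR n (λ i → sumR n (λ j → sumR m (λ r → term (φ r) X (suc i) (suc j))))
    ≡⟨ sumR-cong n (λ i _ → sumR-swap n m _) ⟩
      sumR n (λ i → sumR m (λ r → sum1 n (term (φ r) X (suc i))))
    ≡⟨ sumR-swap n m _ ⟩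
      sumR m (λ r → ev n (φ r) X) ∎
    where
    term-sumFun : ∀ i j → term (sumFun m φ) X i j ≡ sumR m (λ r → term (φ r) X i j)
    term-sumFun i j with i <ᵇ j
    ... | false = sym (sumR-zero m _ (λ _ _ → refl))
    ... | true  = sym (sumR-*ʳ m (X i j) (λ r → φ r i j))

  ev-concentrated : ∀ n a b (φ : Fun) (X : Mat) → 1 ℕ.≤ a → a ℕ.< b → b ℕ.≤ n →
                    (∀ i j → ¬ (a ≡ i × b ≡ j) → φ i j * X i j ≡ 0#) → ev n φ X ≡ φ a b * X a b
  ev-concentrated n (suc a) (suc b) φ X _ a<b b≤n off≡0 =
    trans (sumR-single n a _ (ℕP.<-trans (ℕP.≤-pred a<b) b≤n) otherRows)
          (trans (sumR-single n b _ b≤n otherColumns) atCell)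
    where
    term-off : ∀ i j → ¬ (suc a ≡ i × suc b ≡ j) → term φ X i j ≡ 0#
    term-off i j ne with i <ᵇ j
    ... | false = refl
    ... | true  = off≡0 i j ne
    otherRows : ∀ i → i ℕ.< n → i ≢ a → sum1 n (term φ X (suc i)) ≡ 0#
    otherRows i _ i≢a = sumR-zero n _ (λ j _ → term-off (suc i) (suc j) (λ { (e , _) → i≢a (ℕP.suc-injective (sym e)) }))
    otherColumns : ∀ j → j ℕ.< n → j ≢ b → term φ X (suc a) (suc j) ≡ 0#
    otherColumns j _ j≢b = term-off (suc a) (suc j) (λ { (_ , e) → j≢b (ℕP.suc-injective (sym e)) })
    atCell : term φ X (suc a) (suc b) ≡ φ (suc a) (suc b) * X (suc a) (suc b)
    atCell rewrite <ᵇ-true a<b = refl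

  ev-e* : ∀ n a b X → 1 ℕ.≤ a → a ℕ.< b → b ℕ.≤ n → ev n (e* a b) X ≡ X a b
  ev-e* n a b X 1≤a a<b b≤n =
    trans (ev-concentrated n a b (e* a b) X 1≤a a<b b≤n
             (λ i j ne → trans (cong (_* X i j) (e*-off a b i j ne)) (zeroˡ _)))
          (trans (cong (_* X a b) (e*-on a b)) (*-identityˡ _))

  ev-at-e* : ∀ n a b φ → 1 ℕ.≤ a → a ℕ.< b → b ℕ.≤ n → ev n φ (e* a b) ≡ φ a b
  ev-at-e* n a b φ 1≤a a<b b≤n =
    trans (ev-concentrated n a b φ (e* a b) 1≤a a<b b≤n
             (λ i j ne → trans (cong (φ i j *_) (e*-off a b i j ne)) (zeroʳ _)))
          (trans (cong (φ a b *_) (e*-on a b)) (*-identityʳ _))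

module Matrices {c ℓ} (F : FiniteField c ℓ) (n : ℕ) where
  open FieldFacts F
  open Sums F
  open LinAlg F using (mul; idM; Mat)

  idM-off : ∀ i j → i ≢ j → idM i j ≡ 0#
  idM-off i j i≢j rewrite ≡ᵇ-false i≢j = refl

  idM-diag : ∀ i → idM i i ≡ 1#
  idM-diag i rewrite ≡ᵇ-refl i = refl

  mul-zero : ∀ A B a b → (∀ l → 1 ℕ.≤ l → l ℕ.≤ n → A a l * B l b ≡ 0#) → mul n A B a b ≡ 0#
  mul-zero A B a b off = sumR-zero n _ (λ i i<n → off (suc i) (s≤s z≤n) i<n)

  mul-single : ∀ A B a b k → 1 ℕ.≤ k → k ℕ.≤ n →
               (∀ l → 1 ℕ.≤ l → l ℕ.≤ n → l ℕ.< k ⊎ k ℕ.< l → A a l * B l b ≡ 0#) →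
               mul n A B a b ≡ A a k * B k b
  mul-single A B a b (suc k) _ k≤n off = sumR-single n k _ k≤n outside
    where
    outside : ∀ i → i ℕ.< n → i ≢ k → A a (suc i) * B (suc i) b ≡ 0#
    outside i i<n i≢k with ℕP.<-cmp i k
    ... | tri< i<k _ _ = off (suc i) (s≤s z≤n) i<n (inj₁ (s≤s i<k))
    ... | tri≈ _ i≡k _ = ⊥-elim (i≢k i≡k)
    ... | tri> _ _ k<i = off (suc i) (s≤s z≤n) i<n (inj₂ (s≤s k<i))

  mul-pair : ∀ A B a b k → 1 ℕ.≤ k → suc k ℕ.≤ n →
             (∀ l → 1 ℕ.≤ l → l ℕ.≤ n → l ℕ.< k ⊎ suc k ℕ.< l → A a l * B l b ≡ 0#) →
             mul n A B a b ≡ A a k * B k b + A a (suc k) * B (suc k) b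
  mul-pair A B a b (suc k) _ 1+k≤n off = sumR-pair n k _ 1+k≤n outside
    where
    outside : ∀ i → i ℕ.< n → i ≢ k → i ≢ suc k → A a (suc i) * B (suc i) b ≡ 0#
    outside i i<n i≢k i≢1+k with ℕP.<-cmp i k
    ... | tri< i<k _ _ = off (suc i) (s≤s z≤n) i<n (inj₁ (s≤s i<k))
    ... | tri≈ _ i≡k _ = ⊥-elim (i≢k i≡k)
    ... | tri> _ _ k<i with ℕP.<-cmp i (suc k)
    ...   | tri< i<1+k _ _ = ⊥-elim (ℕP.<-irrefl refl (ℕP.<-≤-trans k<i (ℕP.≤-pred i<1+k)))
    ...   | tri≈ _ i≡1+k _ = ⊥-elim (i≢1+k i≡1+k)
    ...   | tri> _ _ 1+k<i = off (suc i) (s≤s z≤n) i<n (inj₂ (s≤s 1+k<i))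

  zero-left : ∀ {x} y → x ≡ 0# → x * y ≡ 0#
  zero-left y refl = zeroˡ y

  zero-right : ∀ x {y} → y ≡ 0# → x * y ≡ 0#
  zero-right x refl = zeroʳ x

module Unitriangular {c ℓ} (F : FiniteField c ℓ) (n : ℕ) (g h : LinAlg.Mat F)
    (g-unitriangular : LinAlg.IsUnitriangular F n g)
    (hg≡1 : LinAlg.MatEq F n (LinAlg.mul F n h g) (LinAlg.idM F)) where
  open FieldFacts F
  open Matrices F n
  open LinAlg F using (mul; idM; IsStrictUpper; Mat)
  open ≡-Reasoning

  g-diag : ∀ i → 1 ℕ.≤ i → i ℕ.≤ n → g i i ≡ 1#
  g-diag i 1≤i i≤n = ≈⇒≡ (proj₁ g-unitriangular i 1≤i i≤n)

  g-lower : ∀ i j → 1 ℕ.≤ j → j ℕ.< i → i ℕ.≤ n → g i j ≡ 0#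
  g-lower i j 1≤j j<i i≤n =
    ≈⇒≡ (proj₂ g-unitriangular i j (ℕP.≤-trans 1≤j (ℕP.<⇒≤ j<i)) i≤n 1≤j (ℕP.≤-trans (ℕP.<⇒≤ j<i) i≤n) j<i)

  hg-entry : ∀ i j → 1 ℕ.≤ i → i ℕ.≤ n → 1 ℕ.≤ j → j ℕ.≤ n → mul n h g i j ≡ idM i j
  hg-entry i j 1≤i i≤n 1≤j j≤n = ≈⇒≡ (hg≡1 i j 1≤i i≤n 1≤j j≤n)

  hg-column : ∀ i p → 1 ℕ.≤ p → p ℕ.≤ n → (∀ l → 1 ℕ.≤ l → l ℕ.< p → h i l ≡ 0#) →
              mul n h g i p ≡ h i p
  hg-column i p 1≤p p≤n h-left≡0 =
    trans (mul-single h g i p p 1≤p p≤n outside) (trans (cong (h i p *_) (g-diag p 1≤p p≤n)) (*-identityʳ _))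
    where
    outside : ∀ l → 1 ℕ.≤ l → l ℕ.≤ n → l ℕ.< p ⊎ p ℕ.< l → h i l * g l p ≡ 0#
    outside l 1≤l _   (inj₁ l<p) = zero-left (g l p) (h-left≡0 l 1≤l l<p)
    outside l _   l≤n (inj₂ p<l) = zero-right (h i l) (g-lower l p 1≤p p<l l≤n)

  h-lower-upTo : ∀ i → 1 ℕ.≤ i → i ℕ.≤ n → ∀ m p → 1 ℕ.≤ p → p ℕ.< m → p ℕ.< i → h i p ≡ 0#
  h-lower-upTo i 1≤i i≤n (suc m) p 1≤p p<1+m p<i with p ℕ.≟ m
  ... | no p≢m = h-lower-upTo i 1≤i i≤n m p 1≤p (ℕP.≤∧≢⇒< (ℕP.≤-pred p<1+m) p≢m) p<i
  ... | yes refl = begin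
    h i p          ≡⟨ sym (hg-column i p 1≤p p≤n (λ l 1≤l l<p → h-lower-upTo i 1≤i i≤n p l 1≤l l<p (ℕP.<-trans l<p p<i))) ⟩
    mul n h g i p  ≡⟨ hg-entry i p 1≤i i≤n 1≤p p≤n ⟩
    idM i p        ≡⟨ idM-off i p (λ i≡p → ℕP.<-irrefl (sym i≡p) p<i) ⟩
    0#             ∎
    where p≤n = ℕP.≤-trans (ℕP.<⇒≤ p<i) i≤n

  h-lower : ∀ i p → 1 ℕ.≤ i → i ℕ.≤ n → 1 ℕ.≤ p → p ℕ.< i → h i p ≡ 0#
  h-lower i p 1≤i i≤n 1≤p p<i = h-lower-upTo i 1≤i i≤n (suc p) p 1≤p ℕP.≤-refl p<i

  h-diag : ∀ i → 1 ℕ.≤ i → i ℕ.≤ n → h i i ≡ 1#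
  h-diag i 1≤i i≤n = begin
    h i i          ≡⟨ sym (hg-column i i 1≤i i≤n (λ l 1≤l l<i → h-lower i l 1≤i i≤n 1≤l l<i)) ⟩
    mul n h g i i  ≡⟨ hg-entry i i 1≤i i≤n 1≤i i≤n ⟩
    idM i i        ≡⟨ idM-diag i ⟩
    1#             ∎

  h-super : ∀ i → 1 ℕ.≤ i → suc i ℕ.≤ n → h i (suc i) ≡ - g i (suc i)
  h-super i 1≤i 1+i≤n = +-inverseˡ-unique _ _ (trans (+-comm _ _) (begin
      g i (suc i) + h i (suc i)
    ≡⟨ sym (cong₂ _+_ (trans (cong (_* g i (suc i)) (h-diag i 1≤i i≤n)) (*-identityˡ _))
                      (trans (cong (h i (suc i) *_) (g-diag (suc i) (s≤s z≤n) 1+i≤n)) (*-identityʳ _))) ⟩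
      h i i * g i (suc i) + h i (suc i) * g (suc i) (suc i)
    ≡⟨ sym (mul-pair h g i (suc i) i 1≤i 1+i≤n outside) ⟩
      mul n h g i (suc i)
    ≡⟨ hg-entry i (suc i) 1≤i i≤n (s≤s z≤n) 1+i≤n ⟩
      idM i (suc i)
    ≡⟨ idM-off i (suc i) (λ i≡1+i → ℕP.<-irrefl i≡1+i (ℕP.n<1+n i)) ⟩
      0# ∎))
    where
    i≤n = ℕP.<⇒≤ 1+i≤n
    outside : ∀ l → 1 ℕ.≤ l → l ℕ.≤ n → l ℕ.< i ⊎ suc i ℕ.< l → h i l * g l (suc i) ≡ 0#
    outside l 1≤l _   (inj₁ l<i)   = zero-left _ (h-lower i l 1≤i i≤n 1≤l l<i)
    outside l _   l≤n (inj₂ 1+i<l) = zero-right _ (g-lower l (suc i) (s≤s z≤n) 1+i<l l≤n)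

  module _ (X : Mat) (X-strictUpper : IsStrictUpper n X) where
    X-lower : ∀ l m → 1 ℕ.≤ m → m ℕ.≤ l → l ℕ.≤ n → X l m ≡ 0#
    X-lower l m 1≤m m≤l l≤n = ≈⇒≡ (X-strictUpper l m (ℕP.≤-trans 1≤m m≤l) l≤n 1≤m (ℕP.≤-trans m≤l l≤n) m≤l)

    hX-lower : ∀ i m → 1 ℕ.≤ i → i ℕ.≤ n → 1 ℕ.≤ m → m ℕ.≤ i → mul n h X i m ≡ 0#
    hX-lower i m 1≤i i≤n 1≤m m≤i = mul-zero h X i m vanish
      where
      vanish : ∀ l → 1 ℕ.≤ l → l ℕ.≤ n → h i l * X l m ≡ 0#
      vanish l 1≤l l≤n with ℕP.<-cmp l i
      ... | tri< l<i _ _ = zero-left _ (h-lower i l 1≤i i≤n 1≤l l<i)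
      ... | tri≈ _ l≡i _ = zero-right _ (X-lower l m 1≤m (subst (m ℕ.≤_) (sym l≡i) m≤i) l≤n)
      ... | tri> _ _ i<l = zero-right _ (X-lower l m 1≤m (ℕP.≤-trans m≤i (ℕP.<⇒≤ i<l)) l≤n)

    hX-super : ∀ i → 1 ℕ.≤ i → suc i ℕ.≤ n → mul n h X i (suc i) ≡ X i (suc i)
    hX-super i 1≤i 1+i≤n =
      trans (mul-single h X i (suc i) i 1≤i i≤n outside) (trans (cong (_* X i (suc i)) (h-diag i 1≤i i≤n)) (*-identityˡ _))
      where
      i≤n = ℕP.<⇒≤ 1+i≤n
      outside : ∀ l → 1 ℕ.≤ l → l ℕ.≤ n → l ℕ.< i ⊎ i ℕ.< l → h i l * X l (suc i) ≡ 0#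
      outside l 1≤l _   (inj₁ l<i) = zero-left _ (h-lower i l 1≤i i≤n 1≤l l<i)
      outside l _   l≤n (inj₂ i<l) = zero-right _ (X-lower l (suc i) (s≤s z≤n) i<l l≤n)

    hX-super₂ : ∀ i → 1 ℕ.≤ i → suc (suc i) ℕ.≤ n →
                mul n h X i (suc (suc i)) ≡ X i (suc (suc i)) + - g i (suc i) * X (suc i) (suc (suc i))
    hX-super₂ i 1≤i 2+i≤n =
      trans (mul-pair h X i (suc (suc i)) i 1≤i 1+i≤n outside)
            (cong₂ _+_ (trans (cong (_* X i (suc (suc i))) (h-diag i 1≤i i≤n)) (*-identityˡ _))
                       (cong (_* X (suc i) (suc (suc i))) (h-super i 1≤i 1+i≤n)))
      where
      1+i≤n = ℕP.<⇒≤ 2+i≤n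
      i≤n = ℕP.<⇒≤ 1+i≤n
      outside : ∀ l → 1 ℕ.≤ l → l ℕ.≤ n → l ℕ.< i ⊎ suc i ℕ.< l → h i l * X l (suc (suc i)) ≡ 0#
      outside l 1≤l _   (inj₁ l<i)   = zero-left _ (h-lower i l 1≤i i≤n 1≤l l<i)
      outside l _   l≤n (inj₂ 1+i<l) = zero-right _ (X-lower l (suc (suc i)) (s≤s z≤n) 1+i<l l≤n)

    conj-super : ∀ i → 1 ℕ.≤ i → suc i ℕ.≤ n → mul n (mul n h X) g i (suc i) ≡ X i (suc i)
    conj-super i 1≤i 1+i≤n = begin
        mul n (mul n h X) g i (suc i)
      ≡⟨ mul-single (mul n h X) g i (suc i) (suc i) (s≤s z≤n) 1+i≤n outside ⟩
        mul n h X i (suc i) * g (suc i) (suc i)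
      ≡⟨ cong₂ _*_ (hX-super i 1≤i 1+i≤n) (g-diag (suc i) (s≤s z≤n) 1+i≤n) ⟩
        X i (suc i) * 1#
      ≡⟨ *-identityʳ _ ⟩
        X i (suc i) ∎
      where
      outside : ∀ l → 1 ℕ.≤ l → l ℕ.≤ n → l ℕ.< suc i ⊎ suc i ℕ.< l → mul n h X i l * g l (suc i) ≡ 0#
      outside l 1≤l _   (inj₁ l<1+i) = zero-left _ (hX-lower i l 1≤i (ℕP.<⇒≤ 1+i≤n) 1≤l (ℕP.≤-pred l<1+i))
      outside l _   l≤n (inj₂ 1+i<l) = zero-right _ (g-lower l (suc i) (s≤s z≤n) 1+i<l l≤n)

    conj-super₂ : ∀ i → 1 ℕ.≤ i → suc (suc i) ℕ.≤ n →
                  mul n (mul n h X) g i (suc (suc i)) ≡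
                  X i (suc i) * g (suc i) (suc (suc i)) + (X i (suc (suc i)) + - g i (suc i) * X (suc i) (suc (suc i)))
    conj-super₂ i 1≤i 2+i≤n = begin
        mul n (mul n h X) g i (suc (suc i))
      ≡⟨ mul-pair (mul n h X) g i (suc (suc i)) (suc i) (s≤s z≤n) 2+i≤n outside ⟩
        mul n h X i (suc i) * g (suc i) (suc (suc i)) + mul n h X i (suc (suc i)) * g (suc (suc i)) (suc (suc i))
      ≡⟨ cong₂ _+_ (cong (_* g (suc i) (suc (suc i))) (hX-super i 1≤i 1+i≤n))
                   (trans (cong₂ _*_ (hX-super₂ i 1≤i 2+i≤n) (g-diag (suc (suc i)) (s≤s z≤n) 2+i≤n)) (*-identityʳ _)) ⟩
        X i (suc i) * g (suc i) (suc (suc i)) + (X i (suc (suc i)) + - g i (suc i) * X (suc i) (suc (suc i))) ∎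
      where
      1+i≤n = ℕP.<⇒≤ 2+i≤n
      outside : ∀ l → 1 ℕ.≤ l → l ℕ.≤ n → l ℕ.< suc i ⊎ suc (suc i) ℕ.< l →
                mul n h X i l * g l (suc (suc i)) ≡ 0#
      outside l 1≤l _   (inj₁ l<1+i) = zero-left _ (hX-lower i l 1≤i (ℕP.<⇒≤ 1+i≤n) 1≤l (ℕP.≤-pred l<1+i))
      outside l _   l≤n (inj₂ 2+i<l) = zero-right _ (g-lower l (suc (suc i)) (s≤s z≤n) 2+i<l l≤n)

module Bidiagonal {c ℓ} (F : FiniteField c ℓ) (n : ℕ) (x : ℕ → FiniteField.Carrier F) where
  open FieldFacts F
  open Matrices F n
  open LinAlg F using (mul; idM; IsUnitriangular; MatEq; Mat)
  open ≡-Reasoning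

  bidiag : Mat
  bidiag a b = if a ≡ᵇ b then 1# else (if suc a ≡ᵇ b then x a else 0#)

  -- negProd a m = (- x a) (- x (a+1)) ⋯ (- x (a+m-1)), the (a, a+m) entry of the inverse.
  negProd : ℕ → ℕ → Carrier
  negProd a zero    = 1#
  negProd a (suc m) = - x a * negProd (suc a) m

  bidiagInv : Mat
  bidiagInv a b = if b <ᵇ a then 0# else negProd a (b ∸ a)

  bidiag-diag : ∀ a → bidiag a a ≡ 1#
  bidiag-diag a rewrite ≡ᵇ-refl a = refl

  bidiag-super : ∀ a → bidiag a (suc a) ≡ x a
  bidiag-super a rewrite ≡ᵇ-false {a} {suc a} (λ a≡1+a → ℕP.<-irrefl a≡1+a (ℕP.n<1+n a)) | ≡ᵇ-refl a = refl

  bidiag-off : ∀ a b → a ≢ b → suc a ≢ b → bidiag a b ≡ 0#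
  bidiag-off a b a≢b 1+a≢b rewrite ≡ᵇ-false a≢b | ≡ᵇ-false 1+a≢b = refl

  bidiag-offBand : ∀ a b → b ℕ.< a ⊎ suc a ℕ.< b → bidiag a b ≡ 0#
  bidiag-offBand a b (inj₁ b<a) =
    bidiag-off a b (λ a≡b → ℕP.<-irrefl (sym a≡b) b<a) (λ 1+a≡b → ℕP.<-irrefl (sym 1+a≡b) (ℕP.<-trans b<a (ℕP.n<1+n a)))
  bidiag-offBand a b (inj₂ 1+a<b) =
    bidiag-off a b (λ a≡b → ℕP.<-irrefl a≡b (ℕP.<-trans (ℕP.n<1+n a) 1+a<b)) (λ 1+a≡b → ℕP.<-irrefl 1+a≡b 1+a<b)

  bidiagInv-lower : ∀ a b → b ℕ.< a → bidiagInv a b ≡ 0#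
  bidiagInv-lower a b b<a rewrite <ᵇ-true b<a = refl

  bidiagInv-upper : ∀ a m → bidiagInv a (a ℕ.+ m) ≡ negProd a m
  bidiagInv-upper a m
    rewrite <ᵇ-false {a ℕ.+ m} {a} (λ a+m<a → ℕP.<-irrefl refl (ℕP.<-≤-trans a+m<a (ℕP.m≤m+n a m)))
          | ℕP.m+n∸m≡n a m = refl

  bidiagInv-diag : ∀ a → bidiagInv a a ≡ 1#
  bidiagInv-diag a = trans (cong (bidiagInv a) (sym (ℕP.+-identityʳ a))) (bidiagInv-upper a 0)

  bidiagInv-lowerTriangle : ∀ a b → b ℕ.≤ a → bidiagInv a b ≡ idM a b
  bidiagInv-lowerTriangle a b b≤a with ℕP.<-cmp b a
  ... | tri< b<a _ _ = trans (bidiagInv-lower a b b<a) (sym (idM-off a b (λ a≡b → ℕP.<-irrefl (sym a≡b) b<a)))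
  ... | tri≈ _ refl _ = trans (bidiagInv-diag b) (sym (idM-diag b))
  ... | tri> _ _ a<b = ⊥-elim (ℕP.<-irrefl refl (ℕP.<-≤-trans a<b b≤a))

  negProd-sucʳ : ∀ a m → negProd a (suc m) ≡ negProd a m * - x (a ℕ.+ m)
  negProd-sucʳ a zero = begin
    - x a * 1#          ≡⟨ *-comm (- x a) 1# ⟩
    1# * - x a          ≡⟨ cong (λ v → 1# * - x v) (sym (ℕP.+-identityʳ a)) ⟩
    1# * - x (a ℕ.+ 0)  ∎
  negProd-sucʳ a (suc m) = begin
    - x a * negProd (suc a) (suc m)                   ≡⟨ cong (- x a *_) (negProd-sucʳ (suc a) m) ⟩
    - x a * (negProd (suc a) m * - x (suc a ℕ.+ m))   ≡⟨ sym (*-assoc _ _ _) ⟩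
    - x a * negProd (suc a) m * - x (suc a ℕ.+ m)     ≡⟨ cong (λ v → - x a * negProd (suc a) m * - x v) (sym (ℕP.+-suc a m)) ⟩
    - x a * negProd (suc a) m * - x (a ℕ.+ suc m)     ∎

  u*v+-u*v≡0 : ∀ u v → u * v + - u * v ≡ 0#
  u*v+-u*v≡0 u v = trans (cong (u * v +_) (-‿distribˡ-* u v)) (-‿inverseʳ _)

  bidiag-unitriangular : IsUnitriangular n bidiag
  bidiag-unitriangular =
    (λ i _ _ → ≡⇒≈ (bidiag-diag i)) ,
    (λ i j _ _ _ _ j<i → ≡⇒≈ (bidiag-offBand i j (inj₁ j<i)))

  row-identity : ∀ a b → bidiagInv a b + x a * bidiagInv (suc a) b ≡ idM a b
  row-identity a b with ℕP.<-cmp b a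
  ... | tri< b<a _ _ =
    trans (cong₂ _+_ (bidiagInv-lower a b b<a) (zero-right (x a) (bidiagInv-lower (suc a) b (ℕP.<-trans b<a (ℕP.n<1+n a)))))
          (trans (+-identityʳ 0#) (sym (idM-off a b (λ a≡b → ℕP.<-irrefl (sym a≡b) b<a))))
  ... | tri≈ _ refl _ =
    trans (cong₂ _+_ (bidiagInv-diag b) (zero-right (x b) (bidiagInv-lower (suc b) b (ℕP.n<1+n b))))
          (trans (+-identityʳ 1#) (sym (idM-diag b)))
  ... | tri> _ _ a<b with ℕP.m≤n⇒∃[o]m+o≡n a<b
  ...   | m , refl =
    trans (cong₂ _+_ (trans (cong (bidiagInv a) (sym (ℕP.+-suc a m))) (bidiagInv-upper a (suc m)))
                     (cong (x a *_) (bidiagInv-upper (suc a) m)))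
          (trans (trans (+-comm _ _) (u*v+-u*v≡0 (x a) (negProd (suc a) m)))
                 (sym (idM-off a (suc (a ℕ.+ m)) (λ a≡ → ℕP.<-irrefl a≡ (s≤s (ℕP.m≤m+n a m))))))

  column-identity : ∀ a b → bidiagInv a b * x b + bidiagInv a (suc b) ≡ idM a (suc b)
  column-identity a b with ℕP.<-cmp (suc b) a
  ... | tri< 1+b<a _ _ =
    trans (cong₂ _+_ (zero-left (x b) (bidiagInv-lower a b (ℕP.<-trans (ℕP.n<1+n b) 1+b<a))) (bidiagInv-lower a (suc b) 1+b<a))
          (trans (+-identityʳ 0#) (sym (idM-off a (suc b) (λ a≡ → ℕP.<-irrefl (sym a≡) 1+b<a))))
  ... | tri≈ _ refl _ =
    trans (cong₂ _+_ (zero-left (x b) (bidiagInv-lower (suc b) b (ℕP.n<1+n b))) (bidiagInv-diag (suc b)))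
          (trans (+-identityˡ 1#) (sym (idM-diag (suc b))))
  ... | tri> _ _ a<1+b with ℕP.m≤n⇒∃[o]m+o≡n (ℕP.≤-pred a<1+b)
  ...   | m , refl =
    trans (cong₂ _+_ (cong (_* x (a ℕ.+ m)) (bidiagInv-upper a m))
                     (trans (cong (bidiagInv a) (sym (ℕP.+-suc a m))) (trans (bidiagInv-upper a (suc m)) (negProd-sucʳ a m))))
          (trans (trans (sym (*-distribˡ-+ _ _ _)) (trans (cong (negProd a m *_) (-‿inverseʳ _)) (zeroʳ _)))
                 (sym (idM-off a (suc (a ℕ.+ m)) (λ a≡ → ℕP.<-irrefl a≡ (s≤s (ℕP.m≤m+n a m))))))

  bidiag-rightInverse : MatEq n (mul n bidiag bidiagInv) idM
  bidiag-rightInverse a b 1≤a a≤n _ b≤n with ℕP.<-cmp a n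
  ... | tri< a<n _ _ = ≡⇒≈ (begin
      mul n bidiag bidiagInv a b
    ≡⟨ mul-pair bidiag bidiagInv a b a 1≤a a<n (λ l _ _ l∉ → zero-left _ (bidiag-offBand a l l∉)) ⟩
      bidiag a a * bidiagInv a b + bidiag a (suc a) * bidiagInv (suc a) b
    ≡⟨ cong₂ _+_ (trans (cong (_* bidiagInv a b) (bidiag-diag a)) (*-identityˡ _))
                 (cong (_* bidiagInv (suc a) b) (bidiag-super a)) ⟩
      bidiagInv a b + x a * bidiagInv (suc a) b
    ≡⟨ row-identity a b ⟩
      idM a b ∎)
  ... | tri≈ _ refl _ = ≡⇒≈ (begin
      mul n bidiag bidiagInv a b
    ≡⟨ mul-single bidiag bidiagInv a b a 1≤a ℕP.≤-refl outside ⟩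
      bidiag a a * bidiagInv a b
    ≡⟨ trans (cong (_* bidiagInv a b) (bidiag-diag a)) (*-identityˡ _) ⟩
      bidiagInv a b
    ≡⟨ bidiagInv-lowerTriangle a b b≤n ⟩
      idM a b ∎)
    where
    outside : ∀ l → 1 ℕ.≤ l → l ℕ.≤ a → l ℕ.< a ⊎ a ℕ.< l → bidiag a l * bidiagInv l b ≡ 0#
    outside l _ _   (inj₁ l<a) = zero-left _ (bidiag-offBand a l (inj₁ l<a))
    outside l _ l≤a (inj₂ a<l) = ⊥-elim (ℕP.<-irrefl refl (ℕP.<-≤-trans a<l l≤a))
  ... | tri> _ _ n<a = ⊥-elim (ℕP.<-irrefl refl (ℕP.<-≤-trans n<a a≤n))

  bidiag-leftInverse : MatEq n (mul n bidiagInv bidiag) idM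
  bidiag-leftInverse a (suc zero) 1≤a _ _ 1≤n = ≡⇒≈ (begin
      mul n bidiagInv bidiag a 1
    ≡⟨ mul-single bidiagInv bidiag a 1 1 ℕP.≤-refl 1≤n outside ⟩
      bidiagInv a 1 * bidiag 1 1
    ≡⟨ trans (cong (bidiagInv a 1 *_) (bidiag-diag 1)) (*-identityʳ _) ⟩
      bidiagInv a 1
    ≡⟨ bidiagInv-lowerTriangle a 1 1≤a ⟩
      idM a 1 ∎)
    where
    outside : ∀ l → 1 ℕ.≤ l → l ℕ.≤ n → l ℕ.< 1 ⊎ 1 ℕ.< l → bidiagInv a l * bidiag l 1 ≡ 0#
    outside l 1≤l _ (inj₁ l<1) = ⊥-elim (ℕP.<-irrefl refl (ℕP.<-≤-trans l<1 1≤l))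
    outside l _   _ (inj₂ 1<l) = zero-right _ (bidiag-offBand l 1 (inj₁ 1<l))
  bidiag-leftInverse a (suc (suc k)) _ _ _ 2+k≤n = ≡⇒≈ (begin
      mul n bidiagInv bidiag a (suc (suc k))
    ≡⟨ mul-pair bidiagInv bidiag a (suc (suc k)) (suc k) (s≤s z≤n) 2+k≤n outside ⟩
      bidiagInv a (suc k) * bidiag (suc k) (suc (suc k)) + bidiagInv a (suc (suc k)) * bidiag (suc (suc k)) (suc (suc k))
    ≡⟨ cong₂ _+_ (cong (bidiagInv a (suc k) *_) (bidiag-super (suc k)))
                 (trans (cong (bidiagInv a (suc (suc k)) *_) (bidiag-diag (suc (suc k)))) (*-identityʳ _)) ⟩
      bidiagInv a (suc k) * x (suc k) + bidiagInv a (suc (suc k))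
    ≡⟨ column-identity a (suc k) ⟩
      idM a (suc (suc k)) ∎)
    where
    outside : ∀ l → 1 ℕ.≤ l → l ℕ.≤ n → l ℕ.< suc k ⊎ suc (suc k) ℕ.< l → bidiagInv a l * bidiag l (suc (suc k)) ≡ 0#
    outside l _ _ (inj₁ l<1+k)   = zero-right _ (bidiag-offBand l (suc (suc k)) (inj₂ (s≤s l<1+k)))
    outside l _ _ (inj₂ 2+k<l)   = zero-right _ (bidiag-offBand l (suc (suc k)) (inj₁ 2+k<l))

module Recurrence {c ℓ} (F : FiniteField c ℓ) where
  open FieldFacts F
  open Sums F
  open LinAlg F using (sumR)
  open ≡-Reasoning
  private module R = FiniteField F
  open NaturalCoefficientsSolver R.commutativeSemiring (λ _ _ → nothing)

  -- shift T x i = T i x (i+1) - T (i-1) x (i-1) is what conjugation by a unitriangular matrix with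
  -- superdiagonal x adds to the coefficient of e*_{j+i,j+i+1} in λ_T (see Band.ev-lamT-conj).
  previousTerm : (T x : ℕ → Carrier) → ℕ → Carrier
  previousTerm T x zero    = 0#
  previousTerm T x (suc i) = T i * - x i

  shift : (T x : ℕ → Carrier) → ℕ → Carrier
  shift T x i = T i * x (suc i) + previousTerm T x i

  shift-cong : ∀ T {x x′ : ℕ → Carrier} → (∀ i → x i ≡ x′ i) → ∀ i → shift T x i ≡ shift T x′ i
  shift-cong T x≗x′ zero    = cong (λ v → T 0 * v + 0#) (x≗x′ 1)
  shift-cong T x≗x′ (suc i) = cong₂ (λ u v → T (suc i) * u + T i * - v) (x≗x′ (suc (suc i))) (x≗x′ i)

  regroup : ∀ m (T x Y Z : ℕ → Carrier) → T m ≡ 0# →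
            sumR m (λ r → T r * (Y r * x (suc r) + (Z r + - x r * Y (suc r)))) ≡
            sumR m (λ r → T r * Z r) + sumR (suc m) (λ i → shift T x i * Y i)
  regroup m T x Y Z Tm≡0 = begin
      sumR m (λ r → T r * (Y r * x (suc r) + (Z r + - x r * Y (suc r))))
    ≡⟨ sumR-cong m (λ r _ → expand r) ⟩
      sumR m (λ r → T r * Z r + (forward r + backward r))
    ≡⟨ trans (sumR-+ m _ _) (cong (_ +_) (sumR-+ m _ _)) ⟩
      sumR m (λ r → T r * Z r) + (sumR m forward + sumR m backward)
    ≡⟨ cong (sumR m (λ r → T r * Z r) +_) (sym shifted) ⟩
      sumR m (λ r → T r * Z r) + sumR (suc m) (λ i → shift T x i * Y i) ∎
    where
    forward backward previous : ℕ → Carrier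
    forward r  = T r * x (suc r) * Y r
    backward r = T r * - x r * Y (suc r)
    previous i = previousTerm T x i * Y i
    expand : ∀ r → T r * (Y r * x (suc r) + (Z r + - x r * Y (suc r))) ≡ T r * Z r + (forward r + backward r)
    expand r = ≈⇒≡ (solve 6 (λ t y x′ z nx y′ → t :* (y :* x′ :+ (z :+ nx :* y′)) := t :* z :+ (t :* x′ :* y :+ t :* nx :* y′))
                            R.refl (T r) (Y r) (x (suc r)) (Z r) (- x r) (Y (suc r)))
    shifted : sumR (suc m) (λ i → shift T x i * Y i) ≡ sumR m forward + sumR m backward
    shifted = begin
        sumR (suc m) (λ i → shift T x i * Y i)
      ≡⟨ sumR-cong (suc m) (λ i _ → *-distribʳ-+ (Y i) (T i * x (suc i)) (previousTerm T x i)) ⟩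
        sumR (suc m) (λ i → forward i + previous i)
      ≡⟨ sumR-+ (suc m) forward previous ⟩
        (sumR m forward + forward m) + sumR (suc m) previous
      ≡⟨ cong₂ _+_ (trans (cong (sumR m forward +_) (zero-forward-m)) (+-identityʳ _))
                   (trans (sumR-unfoldˡ m previous) (trans (cong (_+ sumR m (λ i → previous (suc i))) (zeroˡ (Y 0))) (+-identityˡ _))) ⟩
        sumR m forward + sumR m backward ∎
      where
      zero-forward-m : forward m ≡ 0#
      zero-forward-m = trans (cong (λ v → v * x (suc m) * Y m) Tm≡0) (trans (cong (_* Y m) (zeroˡ _)) (zeroˡ _))

  odd-suc : ∀ p → 2 ℕ.* suc p ℕ.+ 1 ≡ suc (suc (2 ℕ.* p ℕ.+ 1))
  odd-suc p = trans (ℕP.+-comm (2 ℕ.* suc p) 1)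
                    (trans (cong suc (ℕP.*-suc 2 p)) (cong (λ v → suc (suc v)) (sym (ℕP.+-comm (2 ℕ.* p) 1))))

  -- The weights a p for which Σ_p a p · shift T x (2p+2) telescopes; they are the a_{p+1} of the paper.
  module Telescope (T : ℕ → Carrier) where
    α : ℕ → Carrier
    α zero    = - T 0
    α (suc p) = α p * inv (T (2 ℕ.* p ℕ.+ 1)) * T (suc (2 ℕ.* p ℕ.+ 1))

    a : ℕ → Carrier
    a p = α p * inv (T (2 ℕ.* p ℕ.+ 1))

    telescope : ∀ (x : ℕ → Carrier) d → (∀ p → p ℕ.< d → T (2 ℕ.* p ℕ.+ 1) ≢ 0#) →
                sumR d (λ p → a p * shift T x (suc (2 ℕ.* p ℕ.+ 1))) ≡ shift T x 0 + α d * x (2 ℕ.* d ℕ.+ 1)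
    telescope x zero T≢0 = sym (begin
      (T 0 * x 1 + 0#) + - T 0 * x 1   ≡⟨ cong (_+ - T 0 * x 1) (+-identityʳ _) ⟩
      T 0 * x 1 + - T 0 * x 1          ≡⟨ cong (T 0 * x 1 +_) (-‿distribˡ-* (T 0) (x 1)) ⟩
      T 0 * x 1 + - (T 0 * x 1)        ≡⟨ -‿inverseʳ _ ⟩
      0#                               ∎)
    telescope x (suc d) T≢0 = begin
        sumR d (λ p → a p * shift T x (suc (o p))) + a d * shift T x (suc (o d))
      ≡⟨ cong (_+ a d * shift T x (suc (o d))) (telescope x d (λ p p<d → T≢0 p (ℕP.m<n⇒m<1+n p<d))) ⟩
        (s₀ + α d * x (o d)) + a d * (T (suc (o d)) * x (suc (suc (o d))) + T (o d) * - x (o d))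
      ≡⟨ ≈⇒≡ (solve 8 (λ s₀ αd xo nxo iT Ts xs To →
                         (s₀ :+ αd :* xo) :+ (αd :* iT) :* (Ts :* xs :+ To :* nxo)
                     := s₀ :+ (αd :* xo :+ αd :* (iT :* To) :* nxo) :+ αd :* iT :* Ts :* xs)
                R.refl s₀ (α d) (x (o d)) (- x (o d)) (inv (T (o d))) (T (suc (o d))) (x (suc (suc (o d)))) (T (o d))) ⟩
        s₀ + (α d * x (o d) + α d * (inv (T (o d)) * T (o d)) * - x (o d)) + α (suc d) * x (suc (suc (o d)))
      ≡⟨ cong (λ v → s₀ + v + α (suc d) * x (suc (suc (o d)))) cancel ⟩
        s₀ + 0# + α (suc d) * x (suc (suc (o d)))
      ≡⟨ cong₂ (λ u v → u + α (suc d) * x v) (+-identityʳ s₀) (sym (odd-suc d)) ⟩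
        s₀ + α (suc d) * x (o (suc d)) ∎
      where
      o : ℕ → ℕ
      o p = 2 ℕ.* p ℕ.+ 1
      s₀ = shift T x 0
      cancel : α d * x (o d) + α d * (inv (T (o d)) * T (o d)) * - x (o d) ≡ 0#
      cancel = begin
          α d * x (o d) + α d * (inv (T (o d)) * T (o d)) * - x (o d)
        ≡⟨ cong (λ v → α d * x (o d) + α d * v * - x (o d)) (inverseˡ _ (T≢0 d ℕP.≤-refl)) ⟩
          α d * x (o d) + α d * 1# * - x (o d)
        ≡⟨ cong (λ v → α d * x (o d) + v * - x (o d)) (*-identityʳ _) ⟩
          α d * x (o d) + α d * - x (o d)
        ≡⟨ sym (*-distribˡ-+ _ _ _) ⟩
          α d * (x (o d) + - x (o d))
        ≡⟨ cong (α d *_) (-‿inverseʳ _) ⟩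
          α d * 0#
        ≡⟨ zeroʳ _ ⟩
          0# ∎

    α-nonzero : ∀ p → (∀ i → i ℕ.< suc (2 ℕ.* p ℕ.+ 1) → T i ≢ 0#) → α p ≢ 0#
    α-nonzero zero    T≢0 = -‿nonzero (T 0) (T≢0 0 (s≤s z≤n))
    α-nonzero (suc p) T≢0 =
      *-nonzero _ _ (*-nonzero _ _ (α-nonzero p (λ i i<2p+2 → T≢0 i (ℕP.<-trans i<2p+2 2p+2<2p+4)))
                                   (inv-nonzero _ (T≢0 (2 ℕ.* p ℕ.+ 1) (ℕP.<-trans (ℕP.n<1+n _) 2p+2<2p+4))))
                    (T≢0 (suc (2 ℕ.* p ℕ.+ 1)) 2p+2<2p+4)
      where
      2p+2<2p+4 : suc (2 ℕ.* p ℕ.+ 1) ℕ.< suc (2 ℕ.* suc p ℕ.+ 1)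
      2p+2<2p+4 rewrite odd-suc p = s≤s (s≤s (ℕP.n≤1+n _))

    a-nonzero : ∀ p → (∀ i → i ℕ.< suc (2 ℕ.* p ℕ.+ 1) → T i ≢ 0#) → a p ≢ 0#
    a-nonzero p T≢0 = *-nonzero _ _ (α-nonzero p T≢0) (inv-nonzero _ (T≢0 _ (ℕP.n<1+n _)))

  -- Solves shift T x i = U i for x (i + 1) by recursion on i; x 0 is irrelevant and set to 0#.
  module Solution (T U : ℕ → Carrier) where
    x : ℕ → Carrier
    x zero             = 0#
    x (suc zero)       = (U 0 + - 0#) * inv (T 0)
    x (suc (suc i))    = (U (suc i) + - (T i * - x i)) * inv (T (suc i))

    x-suc : ∀ i → x (suc i) ≡ (U i + - previousTerm T x i) * inv (T i)
    x-suc zero    = refl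
    x-suc (suc i) = refl

    shift-solution : ∀ i → T i ≢ 0# → shift T x i ≡ U i
    shift-solution i T≢0 = begin
        T i * x (suc i) + previousTerm T x i
      ≡⟨ cong (λ v → T i * v + previousTerm T x i) (x-suc i) ⟩
        T i * ((U i + - previousTerm T x i) * inv (T i)) + previousTerm T x i
      ≡⟨ cong (_+ previousTerm T x i) (trans (*-comm _ _) (*-inverse-cancelʳ _ _ T≢0)) ⟩
        (U i + - previousTerm T x i) + previousTerm T x i
      ≡⟨ +-assoc _ _ _ ⟩
        U i + (- previousTerm T x i + previousTerm T x i)
      ≡⟨ cong (U i +_) (-‿inverseˡ _) ⟩
        U i + 0#
      ≡⟨ +-identityʳ _ ⟩
        U i ∎

  -- When T vanishes just past the last odd index, the telescoped identity forces the last equation.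
  lastEquation : ∀ T (x U : ℕ → Carrier) d → (∀ i → i ℕ.< suc (2 ℕ.* d ℕ.+ 1) → T i ≢ 0#) →
                 T (suc (2 ℕ.* d ℕ.+ 1)) ≡ 0# →
                 (∀ i → i ℕ.< suc (2 ℕ.* d ℕ.+ 1) → shift T x i ≡ U i) →
                 U 0 ≡ sumR (suc d) (λ p → Telescope.a T p * U (suc (2 ℕ.* p ℕ.+ 1))) →
                 shift T x (suc (2 ℕ.* d ℕ.+ 1)) ≡ U (suc (2 ℕ.* d ℕ.+ 1))
  lastEquation T x U d T≢0 T-last≡0 shift≡U U₀ =
    *-cancelˡ (a d) _ _ (a-nonzero d T≢0) (+-cancelˡ _ _ _ (begin
        weighted (shift T x) + a d * shift T x m
      ≡⟨ telescope x (suc d) (λ p p<1+d → T≢0 _ (s≤s (odd≤ p p<1+d))) ⟩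
        shift T x 0 + α (suc d) * x (2 ℕ.* suc d ℕ.+ 1)
      ≡⟨ cong (λ v → shift T x 0 + v * x (2 ℕ.* suc d ℕ.+ 1)) (trans (cong (a d *_) T-last≡0) (zeroʳ _)) ⟩
        shift T x 0 + 0# * x (2 ℕ.* suc d ℕ.+ 1)
      ≡⟨ trans (cong (shift T x 0 +_) (zeroˡ _)) (+-identityʳ _) ⟩
        shift T x 0
      ≡⟨ shift≡U 0 (s≤s z≤n) ⟩
        U 0
      ≡⟨ U₀ ⟩
        weighted U + a d * U m
      ≡⟨ cong (_+ a d * U m) (sym (sumR-cong d (λ p p<d → cong (a p *_) (shift≡U _ (s≤s (ℕP.+-monoˡ-< 1 (ℕP.*-monoʳ-< 2 p<d))))))) ⟩
        weighted (shift T x) + a d * U m ∎))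
    where
    open Telescope T
    m = suc (2 ℕ.* d ℕ.+ 1)
    weighted : (ℕ → Carrier) → Carrier
    weighted V = sumR d (λ p → a p * V (suc (2 ℕ.* p ℕ.+ 1)))
    odd≤ : ∀ p → p ℕ.< suc d → 2 ℕ.* p ℕ.+ 1 ℕ.≤ 2 ℕ.* d ℕ.+ 1
    odd≤ p p<1+d = ℕP.+-monoˡ-≤ 1 (ℕP.*-monoʳ-≤ 2 (ℕP.≤-pred p<1+d))

  H : ℕ → (ℕ → Carrier) → Carrier
  H zero    T = 1#
  H (suc d) T = 1# + T 0 * inv (T 1) * H d (λ i → T (suc (suc i)))

  module _ (T : ℕ → Carrier) where
    private
      T′ : ℕ → Carrier
      T′ i = T (suc (suc i))
      s = T 0 * inv (T 1)
      module 𝕋 = Telescope T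
      module 𝕋′ = Telescope T′

    α-suc : ∀ p → 𝕋.α (suc p) ≡ s * 𝕋′.α p
    α-suc zero = begin
      - T 0 * inv (T 1) * T 2     ≡⟨ cong (_* T 2) (-‿distribˡ-* _ _) ⟩
      - (T 0 * inv (T 1)) * T 2   ≡⟨ -‿distribˡ-* _ _ ⟩
      - (s * T 2)                 ≡⟨ sym (-‿distribʳ-* _ _) ⟩
      s * - T 2                   ∎
    α-suc (suc p) = begin
        𝕋.α (suc p) * inv (T (2 ℕ.* suc p ℕ.+ 1)) * T (suc (2 ℕ.* suc p ℕ.+ 1))
      ≡⟨ cong₂ (λ u v → u * inv (T v) * T (suc v)) (α-suc p) (odd-suc p) ⟩
        s * 𝕋′.α p * inv (T′ (2 ℕ.* p ℕ.+ 1)) * T′ (suc (2 ℕ.* p ℕ.+ 1))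
      ≡⟨ ≈⇒≡ (solve 4 (λ s A i t → s :* A :* i :* t := s :* (A :* i :* t)) R.refl _ _ _ _) ⟩
        s * 𝕋′.α (suc p) ∎

    a-suc : ∀ p → 𝕋.a (suc p) ≡ s * 𝕋′.a p
    a-suc p = begin
      𝕋.α (suc p) * inv (T (2 ℕ.* suc p ℕ.+ 1))   ≡⟨ cong₂ (λ u v → u * inv (T v)) (α-suc p) (odd-suc p) ⟩
      s * 𝕋′.α p * inv (T′ (2 ℕ.* p ℕ.+ 1))       ≡⟨ *-assoc _ _ _ ⟩
      s * 𝕋′.a p                                   ∎

  sum-a+H≡1 : ∀ d T → sumR d (Telescope.a T) + H d T ≡ 1#
  sum-a+H≡1 zero    T = +-identityˡ 1#
  sum-a+H≡1 (suc d) T = begin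
      sumR (suc d) (Telescope.a T) + H (suc d) T
    ≡⟨ cong (_+ H (suc d) T) (trans (sumR-unfoldˡ d (Telescope.a T))
          (cong₂ _+_ (-‿distribˡ-* _ _) (trans (sumR-cong d (λ p _ → a-suc T p)) (sumR-*ˡ d s _)))) ⟩
      (- s + s * Σa′) + (1# + s * H′)
    ≡⟨ ≈⇒≡ (solve 5 (λ ns s Σ h o → (ns :+ s :* Σ) :+ (o :+ s :* h) := o :+ (s :* (Σ :+ h) :+ ns)) R.refl (- s) s Σa′ H′ 1#) ⟩
      1# + (s * (Σa′ + H′) + - s)
    ≡⟨ cong (λ v → 1# + (v + - s)) (trans (cong (s *_) (sum-a+H≡1 d T′)) (*-identityʳ s)) ⟩
      1# + (s + - s)
    ≡⟨ trans (cong (1# +_) (-‿inverseʳ s)) (+-identityʳ 1#) ⟩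
      1# ∎
    where
    T′ : ℕ → Carrier
    T′ i = T (suc (suc i))
    s = T 0 * inv (T 1)
    Σa′ = sumR d (Telescope.a T′)
    H′ = H d T′

double : ℕ → ℕ
double zero    = zero
double (suc d) = suc (suc (double d))

double≡2* : ∀ d → double d ≡ 2 ℕ.* d
double≡2* zero    = refl
double≡2* (suc d) = trans (cong (λ v → suc (suc v)) (double≡2* d)) (sym (ℕP.*-suc 2 d))

module ClosedForm where
  open import Data.Integer.Base using (+_)
  open ≡-Reasoning

  +-^ : ∀ N m → + (N ℕ.^ m) ≡ (+ N) ℤ.^ m
  +-^ N zero    = refl
  +-^ N (suc m) = trans (ℤP.pos-* N (N ℕ.^ m)) (cong ((+ N) ℤ.*_) (+-^ N m))

  -- Z d counts the vectors of length 2d (entries in a set of size N) with some property and W d the rest.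
  closedForm : ∀ N (Z W : ℕ → ℕ) → Z 0 ≡ 0 → (∀ d → Z (suc d) ≡ N ℕ.* W d) →
               (∀ d → Z d ℕ.+ W d ≡ N ℕ.^ double d) →
               ∀ d → + suc N ℤ.* + Z d ≡ (+ N) ℤ.^ double d ℤ.- (-1ℤ ℤ.^ d) ℤ.* ((+ N) ℤ.^ d)
  closedForm N Z W Z0≡0 Z-suc Z+W zero rewrite Z0≡0 = ℤP.*-zeroʳ (+ suc N)
  closedForm N Z W Z0≡0 Z-suc Z+W (suc d) = begin
      Q ℤ.* + Z (suc d)
    ≡⟨ cong (λ v → Q ℤ.* + v) (Z-suc d) ⟩
      Q ℤ.* + (N ℕ.* W d)
    ≡⟨ cong (Q ℤ.*_) (ℤP.pos-* N (W d)) ⟩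
      Q ℤ.* (+ N ℤ.* + W d)
    ≡⟨ cong (λ v → Q ℤ.* (+ N ℤ.* v)) Wd≡ ⟩
      Q ℤ.* (+ N ℤ.* (A ℤ.- + Z d))
    ≡⟨ distribute Q (+ N) A (+ Z d) ⟩
      + N ℤ.* (Q ℤ.* A) ℤ.- + N ℤ.* (Q ℤ.* + Z d)
    ≡⟨ cong (λ v → + N ℤ.* (Q ℤ.* A) ℤ.- + N ℤ.* v) (closedForm N Z W Z0≡0 Z-suc Z+W d) ⟩
      + N ℤ.* (Q ℤ.* A) ℤ.- + N ℤ.* (A ℤ.- S ℤ.* B)
    ≡⟨ cong (λ v → + N ℤ.* (v ℤ.* A) ℤ.- + N ℤ.* (A ℤ.- S ℤ.* B)) (ℤP.pos-+ 1 N) ⟩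
      + N ℤ.* ((1ℤ ℤ.+ + N) ℤ.* A) ℤ.- + N ℤ.* (A ℤ.- S ℤ.* B)
    ≡⟨ collect (+ N) A S B ⟩
      + N ℤ.* (+ N ℤ.* A) ℤ.- (-1ℤ ℤ.* S) ℤ.* (+ N ℤ.* B) ∎
    where
    Q = + suc N
    A = (+ N) ℤ.^ double d
    B = (+ N) ℤ.^ d
    S = -1ℤ ℤ.^ d
    cancel : ∀ z w → w ≡ (z ℤ.+ w) ℤ.- z
    cancel = solve-∀
    Wd≡ : + W d ≡ A ℤ.- + Z d
    Wd≡ = begin
        + W d
      ≡⟨ cancel (+ Z d) (+ W d) ⟩
        (+ Z d ℤ.+ + W d) ℤ.- + Z d
      ≡⟨ cong (ℤ._- + Z d) (trans (sym (ℤP.pos-+ (Z d) (W d))) (trans (cong +_ (Z+W d)) (+-^ N (double d)))) ⟩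
        A ℤ.- + Z d ∎
    distribute : ∀ q p a z → q ℤ.* (p ℤ.* (a ℤ.- z)) ≡ p ℤ.* (q ℤ.* a) ℤ.- p ℤ.* (q ℤ.* z)
    distribute = solve-∀
    collect : ∀ p a s b → p ℤ.* ((1ℤ ℤ.+ p) ℤ.* a) ℤ.- p ℤ.* (a ℤ.- s ℤ.* b) ≡
                          p ℤ.* (p ℤ.* a) ℤ.- (-1ℤ ℤ.* s) ℤ.* (p ℤ.* b)
    collect = solve-∀

indicator : Bool → ℕ
indicator b = if b then 1 else 0

indicator-not : ∀ b → indicator (not b) ℕ.+ indicator b ≡ 1
indicator-not true  = refl
indicator-not false = refl

module ListSums {a} {A : Set a} where
  sumL : List A → (A → ℕ) → ℕ
  sumL []       f = 0
  sumL (x ∷ xs) f = f x ℕ.+ sumL xs f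

  sumL-cong : ∀ xs {f g : A → ℕ} → (∀ x → x ∈ xs → f x ≡ g x) → sumL xs f ≡ sumL xs g
  sumL-cong []       f≗g = refl
  sumL-cong (x ∷ xs) f≗g = cong₂ ℕ._+_ (f≗g x (here refl)) (sumL-cong xs (λ y y∈xs → f≗g y (there y∈xs)))

  sumL-+ : ∀ xs (f g : A → ℕ) → sumL xs (λ x → f x ℕ.+ g x) ≡ sumL xs f ℕ.+ sumL xs g
  sumL-+ []       f g = refl
  sumL-+ (x ∷ xs) f g = trans (cong (f x ℕ.+ g x ℕ.+_) (sumL-+ xs f g))
                              (CommutativeSemigroupProperties.interchange ℕP.+-commutativeSemigroup (f x) (g x) _ _)

  sumL-++ : ∀ xs ys (f : A → ℕ) → sumL (xs ++ ys) f ≡ sumL xs f ℕ.+ sumL ys f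
  sumL-++ []       ys f = refl
  sumL-++ (x ∷ xs) ys f = trans (cong (f x ℕ.+_) (sumL-++ xs ys f)) (sym (ℕP.+-assoc (f x) _ _))

  sumL-const : ∀ xs k → sumL xs (λ _ → k) ≡ length xs ℕ.* k
  sumL-const []       k = refl
  sumL-const (x ∷ xs) k = cong (k ℕ.+_) (sumL-const xs k)

  sumL-zero : ∀ xs (f : A → ℕ) → (∀ x → x ∈ xs → f x ≡ 0) → sumL xs f ≡ 0
  sumL-zero xs f f≗0 = trans (sumL-cong xs f≗0) (trans (sumL-const xs 0) (ℕP.*-zeroʳ (length xs)))

  length≡sumL : ∀ xs → length xs ≡ sumL xs (λ _ → 1)
  length≡sumL xs = sym (trans (sumL-const xs 1) (ℕP.*-identityʳ _))

  length-filter : ∀ {p} {P : A → Set p} (P? : ∀ x → Dec (P x)) xs →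
                  length (filter P? xs) ≡ sumL xs (λ x → indicator (does (P? x)))
  length-filter P? [] = refl
  length-filter P? (x ∷ xs) with does (P? x)
  ... | true  = cong suc (length-filter P? xs)
  ... | false = length-filter P? xs

open ListSums

sumL-map : ∀ {a b} {A : Set a} {B : Set b} (g : A → B) xs (f : B → ℕ) → sumL (map g xs) f ≡ sumL xs (λ x → f (g x))
sumL-map g []       f = refl
sumL-map g (x ∷ xs) f = cong (f (g x) ℕ.+_) (sumL-map g xs f)

sumL-swap : ∀ {a b} {A : Set a} {B : Set b} xs ys (f : A → B → ℕ) →
            sumL xs (λ x → sumL ys (f x)) ≡ sumL ys (λ y → sumL xs (λ x → f x y))
sumL-swap []       ys f = sym (sumL-zero ys _ (λ _ _ → refl))
sumL-swap (x ∷ xs) ys f = trans (cong (sumL ys (f x) ℕ.+_) (sumL-swap xs ys f)) (sym (sumL-+ ys (f x) _))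

sumL-cartesianProductWith : ∀ {a b c} {A : Set a} {B : Set b} {C : Set c} (h : A → B → C) xs ys (f : C → ℕ) →
                            sumL (cartesianProductWith h xs ys) f ≡ sumL xs (λ x → sumL ys (λ y → f (h x y)))
sumL-cartesianProductWith h []       ys f = refl
sumL-cartesianProductWith h (x ∷ xs) ys f =
  trans (sumL-++ (map (h x) ys) _ f) (cong₂ ℕ._+_ (sumL-map (h x) ys f) (sumL-cartesianProductWith h xs ys f))

module Counting {c ℓ} (F : FiniteField c ℓ) where
  open FieldFacts F
  open Recurrence F using (H)
  open LinAlg F using (get; Nonzero)
  private
    module R = FiniteField F
    module Enum = Bijection R.enum
  open ≡-Reasoning

  isZero : Carrier → Bool
  isZero x = does (x ≟ 0#)

  isZero-true : ∀ {x} → x ≡ 0# → isZero x ≡ true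
  isZero-true {x} = dec-true (x ≟ 0#)

  isZero-false : ∀ {x} → x ≢ 0# → isZero x ≡ false
  isZero-false {x} = dec-false (x ≟ 0#)

  isZero-*-nonzero : ∀ y z → y ≢ 0# → isZero (y * z) ≡ isZero z
  isZero-*-nonzero y z y≢0 with z ≟ 0#
  ... | yes z≡0 = trans (isZero-true (trans (cong (y *_) z≡0) (zeroʳ y))) (sym (isZero-true z≡0))
  ... | no z≢0  = trans (isZero-false (*-nonzero y z y≢0 z≢0)) (sym (isZero-false z≢0))

  count-absent : ∀ xs v → v ∉ xs → sumL xs (λ x → indicator (does (x ≟ v))) ≡ 0
  count-absent xs v v∉xs = sumL-zero xs _ absent
    where
    absent : ∀ x → x ∈ xs → indicator (does (x ≟ v)) ≡ 0
    absent x x∈xs = cong indicator (dec-false (x ≟ v) (λ { refl → v∉xs x∈xs }))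

  count-unique : ∀ xs v → Unique xs → v ∈ xs → sumL xs (λ x → indicator (does (x ≟ v))) ≡ 1
  count-unique (x ∷ xs) v (x∉xs ∷ unique) v∈x∷xs with x ≟ v
  ... | yes refl = cong₂ ℕ._+_ (cong indicator (dec-true (x ≟ x) refl))
                            (count-absent xs x (λ x∈xs → ListAll.lookup x∉xs x∈xs refl))
  ... | no x≢v with v∈x∷xs
  ...   | here v≡x   = ⊥-elim (x≢v (sym v≡x))
  ...   | there v∈xs = cong₂ ℕ._+_ (cong indicator (dec-false (x ≟ v) x≢v)) (count-unique xs v unique v∈xs)

  elements : List Carrier
  elements = map Enum.to (allFin R.q)

  ∈-elements : ∀ x → x ∈ elements
  ∈-elements x with Enum.surjective x
  ... | i , to-i≡x = subst (_∈ elements) (to-i≡x refl) (∈P.∈-map⁺ Enum.to (∈P.∈-allFin i))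

  elements-unique : Unique elements
  elements-unique = UniqueP.map⁺ Enum.injective (UniqueP.allFin⁺ R.q)

  nonzero? : ∀ x → Dec (x ≢ 0#)
  nonzero? x = ¬? (x ≟ 0#)

  units : List Carrier
  units = filter nonzero? elements

  units-unique : Unique units
  units-unique = UniqueP.filter⁺ nonzero? elements-unique

  ∈-units⁺ : ∀ {x} → x ≢ 0# → x ∈ units
  ∈-units⁺ {x} x≢0 = ∈P.∈-filter⁺ nonzero? (∈-elements x) x≢0

  ∈-units⁻ : ∀ {x} → x ∈ units → x ≢ 0#
  ∈-units⁻ x∈units = proj₂ (∈P.∈-filter⁻ nonzero? {xs = elements} x∈units)

  #units : ℕ
  #units = length units

  q≡1+#units : R.q ≡ suc #units
  q≡1+#units = begin
      R.q
    ≡⟨ sym (trans (ListP.length-map Enum.to (allFin R.q)) (ListP.length-tabulate (λ i → i))) ⟩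
      length elements
    ≡⟨ length≡sumL elements ⟩
      sumL elements (λ _ → 1)
    ≡⟨ sym (sumL-cong elements (λ x _ → indicator-not (isZero x))) ⟩
      sumL elements (λ x → indicator (not (isZero x)) ℕ.+ indicator (isZero x))
    ≡⟨ sumL-+ elements _ _ ⟩
      sumL elements (λ x → indicator (not (isZero x))) ℕ.+ sumL elements (λ x → indicator (isZero x))
    ≡⟨ cong₂ ℕ._+_ (sym (length-filter nonzero? elements)) (count-unique elements 0# elements-unique (∈-elements 0#)) ⟩
      #units ℕ.+ 1
    ≡⟨ ℕP.+-comm #units 1 ⟩
      suc #units ∎

  unitVectors : ∀ m → List (Vec Carrier m)
  unitVectors zero    = [] ∷ []
  unitVectors (suc m) = cartesianProductWith _∷_ units (unitVectors m)

  unitVectors-unique : ∀ m → Unique (unitVectors m)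
  unitVectors-unique zero    = ListAll.[] ∷ []
  unitVectors-unique (suc m) =
    UniqueP.cartesianProductWith⁺ _∷_ (λ eq → VecP.∷-injectiveˡ eq , VecP.∷-injectiveʳ eq) units-unique (unitVectors-unique m)

  ∈-unitVectors⁺ : ∀ {m} (t : Vec Carrier m) → All Nonzero t → t ∈ unitVectors m
  ∈-unitVectors⁺ []      []         = here refl
  ∈-unitVectors⁺ (x ∷ t) (x≉0 ∷ t≉0) =
    ∈P.∈-cartesianProductWith⁺ _∷_ (∈-units⁺ (λ x≡0 → x≉0 (≡⇒≈ x≡0))) (∈-unitVectors⁺ t t≉0)

  ∈-unitVectors⁻ : ∀ {m} (t : Vec Carrier m) → t ∈ unitVectors m → All Nonzero t
  ∈-unitVectors⁻ [] _ = []
  ∈-unitVectors⁻ {suc m} (x ∷ t) x∷t∈ with ∈P.∈-cartesianProductWith⁻ _∷_ units (unitVectors m) x∷t∈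
  ... | y , s , y∈units , s∈ , x∷t≡y∷s =
    subst Nonzero (sym (VecP.∷-injectiveˡ x∷t≡y∷s)) (λ y≈0 → ∈-units⁻ y∈units (≈⇒≡ y≈0))
    ∷ ∈-unitVectors⁻ t (subst (_∈ unitVectors m) (sym (VecP.∷-injectiveʳ x∷t≡y∷s)) s∈)

  length-unitVectors : ∀ m → length (unitVectors m) ≡ #units ℕ.^ m
  length-unitVectors zero    = refl
  length-unitVectors (suc m) = begin
      length (unitVectors (suc m))
    ≡⟨ length≡sumL (unitVectors (suc m)) ⟩
      sumL (unitVectors (suc m)) (λ _ → 1)
    ≡⟨ sumL-cartesianProductWith _∷_ units (unitVectors m) (λ _ → 1) ⟩
      sumL units (λ _ → sumL (unitVectors m) (λ _ → 1))
    ≡⟨ sumL-const units _ ⟩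
      #units ℕ.* sumL (unitVectors m) (λ _ → 1)
    ≡⟨ cong (#units ℕ.*_) (trans (sym (length≡sumL (unitVectors m))) (length-unitVectors m)) ⟩
      #units ℕ.* #units ℕ.^ m ∎

  -- The only root is x = - y⁻¹.
  count-roots : ∀ y → sumL units (λ x → indicator (isZero (1# + x * y))) ≡ indicator (not (isZero y))
  count-roots y with y ≟ 0#
  ... | yes y≡0 = trans (sumL-zero units _ (λ x _ → cong indicator (isZero-false (1+x*0≢0 x))))
                        (cong (λ b → indicator (not b)) (sym (isZero-true y≡0)))
    where
    1+x*0≢0 : ∀ x → 1# + x * y ≢ 0#
    1+x*0≢0 x p = 1≢0 (trans (sym (+-identityʳ 1#)) (trans (cong (1# +_) (trans (sym (zeroʳ x)) (cong (x *_) (sym y≡0)))) p))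
  ... | no y≢0 = begin
      sumL units (λ x → indicator (isZero (1# + x * y)))
    ≡⟨ sumL-cong units (λ x _ → cong indicator (root⇔ x)) ⟩
      sumL units (λ x → indicator (does (x ≟ root)))
    ≡⟨ count-unique units root units-unique (∈-units⁺ (-‿nonzero _ (inv-nonzero y y≢0))) ⟩
      1
    ≡⟨ cong (λ b → indicator (not b)) (sym (isZero-false y≢0)) ⟩
      indicator (not (isZero y)) ∎
    where
    root = - inv y
    root⇔ : ∀ x → isZero (1# + x * y) ≡ does (x ≟ root)
    root⇔ x with x ≟ root
    ... | yes refl = trans (isZero-true 1+root*y≡0) (sym (dec-true (root ≟ root) refl))
      where
      1+root*y≡0 : 1# + root * y ≡ 0#
      1+root*y≡0 = begin
        1# + - inv y * y    ≡⟨ cong (1# +_) (trans (-‿distribˡ-* _ _) (cong -_ (inverseˡ y y≢0))) ⟩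
        1# + - 1#           ≡⟨ -‿inverseʳ 1# ⟩
        0#                  ∎
    ... | no x≢root = trans (isZero-false (λ 1+xy≡0 → x≢root (begin
      x                   ≡⟨ sym (trans (*-assoc x y (inv y)) (trans (cong (x *_) (inverseʳ y y≢0)) (*-identityʳ x))) ⟩
      (x * y) * inv y     ≡⟨ cong (_* inv y) (+-inverseˡ-unique (x * y) 1# (trans (+-comm _ _) 1+xy≡0)) ⟩
      - 1# * inv y        ≡⟨ -‿distribˡ-* _ _ ⟩
      - (1# * inv y)      ≡⟨ cong -_ (*-identityˡ _) ⟩
      root                ∎))) (sym (dec-false (x ≟ root) x≢root))

  HIsZero : ∀ d {m} → Vec Carrier m → Bool
  HIsZero d t = isZero (H d (get t))

  #H-zero #H-nonzero : ℕ → ℕ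
  #H-zero d    = sumL (unitVectors (double d)) (λ t → indicator (HIsZero d t))
  #H-nonzero d = sumL (unitVectors (double d)) (λ t → indicator (not (HIsZero d t)))

  #H-zero-0 : #H-zero 0 ≡ 0
  #H-zero-0 rewrite isZero-false {1#} 1≢0 = refl

  #H-zero+#H-nonzero : ∀ d → #H-zero d ℕ.+ #H-nonzero d ≡ #units ℕ.^ double d
  #H-zero+#H-nonzero d = begin
      #H-zero d ℕ.+ #H-nonzero d
    ≡⟨ sym (sumL-+ vectors _ _) ⟩
      sumL vectors (λ t → indicator (HIsZero d t) ℕ.+ indicator (not (HIsZero d t)))
    ≡⟨ sumL-cong vectors (λ t _ → trans (ℕP.+-comm (indicator (HIsZero d t)) _) (indicator-not (HIsZero d t))) ⟩
      sumL vectors (λ _ → 1)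
    ≡⟨ trans (sym (length≡sumL vectors)) (length-unitVectors (double d)) ⟩
      #units ℕ.^ double d ∎
    where vectors = unitVectors (double d)

  -- H (d+1) (x ∷ y ∷ r) = 1 + x y⁻¹ H d r, so for each y and r exactly one x kills it iff H d r ≠ 0.
  #H-zero-suc : ∀ d → #H-zero (suc d) ≡ #units ℕ.* #H-nonzero d
  #H-zero-suc d = begin
      #H-zero (suc d)
    ≡⟨ sumL-cartesianProductWith _∷_ units (cartesianProductWith _∷_ units vectors) _ ⟩
      sumL units (λ x → sumL (cartesianProductWith _∷_ units vectors) (λ t → indicator (HIsZero (suc d) (x ∷ t))))
    ≡⟨ sumL-cong units (λ x _ → sumL-cartesianProductWith _∷_ units vectors _) ⟩
      sumL units (λ x → sumL units (λ y → sumL vectors (λ r → vanishes x y r)))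
    ≡⟨ sumL-swap units units _ ⟩
      sumL units (λ y → sumL units (λ x → sumL vectors (λ r → vanishes x y r)))
    ≡⟨ sumL-cong units (λ y _ → sumL-swap units vectors _) ⟩
      sumL units (λ y → sumL vectors (λ r → sumL units (λ x → vanishes x y r)))
    ≡⟨ sumL-cong units (λ y y∈units → sumL-cong vectors (λ r _ → one-root y (∈-units⁻ y∈units) r)) ⟩
      sumL units (λ y → #H-nonzero d)
    ≡⟨ sumL-const units (#H-nonzero d) ⟩
      #units ℕ.* #H-nonzero d ∎
    where
    vectors = unitVectors (double d)
    vanishes : Carrier → Carrier → Vec Carrier (double d) → ℕ
    vanishes x y r = indicator (isZero (1# + x * inv y * H d (get r)))
    one-root : ∀ y → y ≢ 0# → ∀ r → sumL units (λ x → vanishes x y r) ≡ indicator (not (HIsZero d r))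
    one-root y y≢0 r = begin
        sumL units (λ x → vanishes x y r)
      ≡⟨ sumL-cong units (λ x _ → cong (λ v → indicator (isZero (1# + v))) (*-assoc x (inv y) (H d (get r)))) ⟩
        sumL units (λ x → indicator (isZero (1# + x * (inv y * H d (get r)))))
      ≡⟨ count-roots _ ⟩
        indicator (not (isZero (inv y * H d (get r))))
      ≡⟨ cong (λ b → indicator (not b)) (isZero-*-nonzero (inv y) _ (inv-nonzero y y≢0)) ⟩
        indicator (not (HIsZero d r)) ∎

module Vectors {c ℓ} (F : FiniteField c ℓ) where
  open FieldFacts F
  open LinAlg F using (get; Nonzero)

  vecFrom : ∀ m → (ℕ → Carrier) → Vec Carrier m
  vecFrom zero    f = []
  vecFrom (suc m) f = f 0 ∷ vecFrom m (λ i → f (suc i))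

  get-vecFrom : ∀ m f i → i ℕ.< m → get (vecFrom m f) i ≡ f i
  get-vecFrom (suc m) f zero    _         = refl
  get-vecFrom (suc m) f (suc i) (s≤s i<m) = get-vecFrom m (λ i → f (suc i)) i i<m

  vecFrom-nonzero : ∀ m f → (∀ i → i ℕ.< m → f i ≢ 0#) → All Nonzero (vecFrom m f)
  vecFrom-nonzero zero    f f≢0 = []
  vecFrom-nonzero (suc m) f f≢0 =
    (λ f0≈0 → f≢0 0 (s≤s z≤n) (≈⇒≡ f0≈0)) ∷ vecFrom-nonzero m (λ i → f (suc i)) (λ i i<m → f≢0 (suc i) (s≤s i<m))

  get-beyond : ∀ {m} (v : Vec Carrier m) i → m ℕ.≤ i → get v i ≡ 0#
  get-beyond []      i       _         = refl
  get-beyond (x ∷ v) (suc i) (s≤s m≤i) = get-beyond v i m≤i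

  get-nonzero : ∀ {m} (v : Vec Carrier m) → All Nonzero v → ∀ i → i ℕ.< m → get v i ≢ 0#
  get-nonzero (x ∷ v) (x≉0 ∷ _)  zero    _         x≡0 = x≉0 (≡⇒≈ x≡0)
  get-nonzero (x ∷ v) (_ ∷ v≉0) (suc i) (s≤s i<m)     = get-nonzero v v≉0 i i<m

module Band {c ℓ} (F : FiniteField c ℓ) (n j k : ℕ) (1≤j : 1 ℕ.≤ j) (j≤k : j ℕ.≤ k) (k+2≤n : k ℕ.+ 2 ℕ.≤ n)
    (t : Vec (FiniteField.Carrier F) (suc (k ∸ j))) where
  open FieldFacts F
  open Sums F
  open Functionals F
  open Recurrence F using (shift; regroup)
  open Vectors F
  open LinAlg F using (sumR; mul; idM; IsUnitriangular; IsStrictUpper; MatEq; Mat; Fun; ev; e*; _⊕_; _·_;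
                       lamT; uSum; gamma; get)
  open ≡-Reasoning

  M : ℕ
  M = suc (k ∸ j)

  T : ℕ → Carrier
  T = get t

  Y Z : Mat → ℕ → Carrier
  Y X i = X (j ℕ.+ i) (suc (j ℕ.+ i))
  Z X r = X (j ℕ.+ r) (suc (suc (j ℕ.+ r)))

  superdiagonal : Mat → ℕ → Carrier
  superdiagonal g = Y g

  coeff : Carrier → Vec Carrier M → ℕ → Carrier
  coeff u₀ u i = if i ≡ᵇ 0 then u₀ else get u (i ∸ 1)

  bandSum : Mat → (ℕ → Carrier) → Carrier
  bandSum X w = sumR M (λ r → T r * Z X r) + sumR (suc M) (λ i → w i * Y X i)

  bandSum-cong : ∀ X {w w′ : ℕ → Carrier} → (∀ i → i ℕ.< suc M → w i ≡ w′ i) → bandSum X w ≡ bandSum X w′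
  bandSum-cong X w≗w′ = cong (sumR M (λ r → T r * Z X r) +_) (sumR-cong (suc M) (λ i i<1+M → cong (_* Y X i) (w≗w′ i i<1+M)))

  T-M≡0 : T M ≡ 0#
  T-M≡0 = get-beyond t M ℕP.≤-refl

  2+k≤n : suc (suc k) ℕ.≤ n
  2+k≤n = subst (ℕ._≤ n) (ℕP.+-comm k 2) k+2≤n

  j+i≤1+k : ∀ i → i ℕ.< suc M → j ℕ.+ i ℕ.≤ suc k
  j+i≤1+k i i<1+M = ℕP.≤-trans (ℕP.+-monoʳ-≤ j (ℕP.≤-pred i<1+M))
                               (ℕP.≤-reflexive (trans (ℕP.+-suc j (k ∸ j)) (cong suc (ℕP.m+[n∸m]≡n j≤k))))

  1≤j+i : ∀ i → 1 ℕ.≤ j ℕ.+ i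
  1≤j+i i = ℕP.≤-trans 1≤j (ℕP.m≤m+n j i)

  Y-inRange : ∀ i → i ℕ.< suc M → suc (j ℕ.+ i) ℕ.≤ n
  Y-inRange i i<1+M = ℕP.≤-trans (s≤s (j+i≤1+k i i<1+M)) 2+k≤n

  Z-inRange : ∀ r → r ℕ.< M → suc (suc (j ℕ.+ r)) ℕ.≤ n
  Z-inRange r r<M = ℕP.≤-trans (s≤s (subst (ℕ._≤ suc k) (ℕP.+-suc j r) (j+i≤1+k (suc r) (s≤s r<M)))) 2+k≤n

  ev-lamT : ∀ X → ev n (lamT j k t) X ≡ sumR M (λ r → T r * Z X r)
  ev-lamT X = trans (ev-sumFun n M (λ r → get t r · e* (j ℕ.+ r) (j ℕ.+ r ℕ.+ 2)) X) (sumR-cong M term)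
    where
    term : ∀ r → r ℕ.< M → ev n (get t r · e* (j ℕ.+ r) (j ℕ.+ r ℕ.+ 2)) X ≡ T r * Z X r
    term r r<M rewrite ℕP.+-comm (j ℕ.+ r) 2 =
      trans (ev-· n (T r) (e* (j ℕ.+ r) (suc (suc (j ℕ.+ r)))) X)
            (cong (T r *_) (ev-e* n (j ℕ.+ r) (suc (suc (j ℕ.+ r))) X (1≤j+i r) (ℕP.n≤1+n _) (Z-inRange r r<M)))

  ev-uSum : ∀ u₀ u X → ev n (uSum j u₀ u) X ≡ sumR (suc M) (λ i → coeff u₀ u i * Y X i)
  ev-uSum u₀ u X = trans (ev-sumFun n (suc M) (λ i → coeff u₀ u i · e* (i ℕ.+ j) (i ℕ.+ j ℕ.+ 1)) X) (sumR-cong (suc M) term)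
    where
    term : ∀ i → i ℕ.< suc M → ev n (coeff u₀ u i · e* (i ℕ.+ j) (i ℕ.+ j ℕ.+ 1)) X ≡ coeff u₀ u i * Y X i
    term i i<1+M rewrite ℕP.+-comm (i ℕ.+ j) 1 | ℕP.+-comm i j =
      trans (ev-· n (coeff u₀ u i) (e* (j ℕ.+ i) (suc (j ℕ.+ i))) X)
            (cong (coeff u₀ u i *_) (ev-e* n (j ℕ.+ i) (suc (j ℕ.+ i)) X (1≤j+i i) ℕP.≤-refl (Y-inRange i i<1+M)))

  ev-gamma : ∀ X → ev n (gamma j k) X ≡ sumR (suc M) (λ i → 1# * Y X i)
  ev-gamma X = trans (ev-sumFun n (suc M) (λ r → e* (j ℕ.+ r) (j ℕ.+ r ℕ.+ 1)) X) (sumR-cong (suc M) term)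
    where
    term : ∀ i → i ℕ.< suc M → ev n (e* (j ℕ.+ i) (j ℕ.+ i ℕ.+ 1)) X ≡ 1# * Y X i
    term i i<1+M rewrite ℕP.+-comm (j ℕ.+ i) 1 =
      trans (ev-e* n (j ℕ.+ i) (suc (j ℕ.+ i)) X (1≤j+i i) ℕP.≤-refl (Y-inRange i i<1+M)) (sym (*-identityˡ _))

  ev-bandForm : ∀ u₀ u X → ev n (lamT j k t ⊕ uSum j u₀ u) X ≡ bandSum X (coeff u₀ u)
  ev-bandForm u₀ u X = trans (ev-⊕ n (lamT j k t) (uSum j u₀ u) X) (cong₂ _+_ (ev-lamT X) (ev-uSum u₀ u X))

  ev-lamT⊕gamma : ∀ X → ev n (lamT j k t ⊕ gamma j k) X ≡ bandSum X (λ _ → 1#)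
  ev-lamT⊕gamma X = trans (ev-⊕ n (lamT j k t) (gamma j k) X) (cong₂ _+_ (ev-lamT X) (ev-gamma X))

  1+j≤n : suc j ℕ.≤ n
  1+j≤n = ℕP.≤-trans (s≤s (ℕP.≤-trans j≤k (ℕP.n≤1+n k))) 2+k≤n

  ev-e*₀ : ∀ u X → ev n (u · e* j (j ℕ.+ 1)) X ≡ u * Y X 0
  ev-e*₀ u X rewrite ℕP.+-identityʳ j | ℕP.+-comm j 1 =
    trans (ev-· n u (e* j (suc j)) X) (cong (u *_) (ev-e* n j (suc j) X 1≤j ℕP.≤-refl 1+j≤n))

  bandCoordinate : ∀ (μ : Fun) (w : ℕ → Carrier) →
    (∀ X → IsStrictUpper n X → ev n μ X ≡ bandSum X w) →
    ∀ i → i ℕ.< suc M → μ (j ℕ.+ i) (suc (j ℕ.+ i)) ≡ w i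
  bandCoordinate μ w ev-μ i i<1+M = begin
      μ a (suc a)
    ≡⟨ sym (ev-at-e* n a (suc a) μ (1≤j+i i) ℕP.≤-refl (Y-inRange i i<1+M)) ⟩
      ev n μ E
    ≡⟨ ev-μ E (e*-strictUpper n a (suc a) ℕP.≤-refl) ⟩
      sumR M (λ r → T r * Z E r) + sumR (suc M) (λ i′ → w i′ * Y E i′)
    ≡⟨ cong₂ _+_ (sumR-zero M _ (λ r _ → trans (cong (T r *_) (e*-off a (suc a) _ _ notZ)) (zeroʳ _)))
                 (sumR-single (suc M) i _ i<1+M (λ i′ _ i′≢i → trans (cong (w i′ *_) (e*-off a (suc a) _ _ (notY i′ i′≢i))) (zeroʳ _))) ⟩
      0# + w i * Y E i
    ≡⟨ trans (+-identityˡ _) (trans (cong (w i *_) (e*-on a (suc a))) (*-identityʳ _)) ⟩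
      w i ∎
    where
    a = j ℕ.+ i
    E = e* a (suc a)
    notZ : ∀ {r} → ¬ (a ≡ j ℕ.+ r × suc a ≡ suc (suc (j ℕ.+ r)))
    notZ (a≡ , 1+a≡) = ℕP.<-irrefl (trans (sym a≡) (ℕP.suc-injective 1+a≡)) (ℕP.n<1+n _)
    notY : ∀ i′ → i′ ≢ i → ¬ (a ≡ j ℕ.+ i′ × suc a ≡ suc (j ℕ.+ i′))
    notY i′ i′≢i (a≡ , _) = i′≢i (sym (ℕP.+-cancelˡ-≡ j i i′ a≡))

  module _ (g h : Mat) (g-unitriangular : IsUnitriangular n g) (hg≡1 : MatEq n (mul n h g) idM)
           (X : Mat) (X-strictUpper : IsStrictUpper n X) where
    open Unitriangular F n g h g-unitriangular hg≡1

    ev-lamT-conj : ev n (lamT j k t) (mul n (mul n h X) g) ≡ bandSum X (shift T (superdiagonal g))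
    ev-lamT-conj = trans (ev-lamT (mul n (mul n h X) g))
                         (trans (sumR-cong M entry) (regroup M T (superdiagonal g) (Y X) (Z X) T-M≡0))
      where
      entry : ∀ r → r ℕ.< M → T r * Z (mul n (mul n h X) g) r ≡
              T r * (Y X r * superdiagonal g (suc r) + (Z X r + - superdiagonal g r * Y X (suc r)))
      entry r r<M rewrite ℕP.+-suc j r = cong (T r *_) (conj-super₂ X X-strictUpper (j ℕ.+ r) (1≤j+i r) (Z-inRange r r<M))

    ev-e*₀-conj : ∀ u → ev n (u · e* j (j ℕ.+ 1)) (mul n (mul n h X) g) ≡ u * Y X 0
    ev-e*₀-conj u = trans (ev-e*₀ u (mul n (mul n h X) g))
                          (cong (u *_) (trans (cong (λ v → mul n (mul n h X) g v (suc v)) (ℕP.+-identityʳ j))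
                                       (trans (conj-super X X-strictUpper j 1≤j 1+j≤n)
                                              (cong (λ v → X v (suc v)) (sym (ℕP.+-identityʳ j))))))

module Orbit {c ℓ} (F : FiniteField c ℓ) (n j k : ℕ) (1≤j : 1 ℕ.≤ j) (j≤k : j ℕ.≤ k) (k+2≤n : k ℕ.+ 2 ℕ.≤ n)
    (t : Vec (FiniteField.Carrier F) (suc (k ∸ j))) (d′ : ℕ) (M≡ : suc (k ∸ j) ≡ suc (2 ℕ.* d′ ℕ.+ 1))
    (t≢0 : All (LinAlg.Nonzero F) t) where
  open FieldFacts F
  open Sums F
  open Functionals F using (ev-⊕)
  open Recurrence F
  open Vectors F
  open Band F n j k 1≤j j≤k k+2≤n t
  open LinAlg F using (sumR; mul; IsStrictUpper; Fun; ev; e*; _⊕_; _·_; lamT; uSum; gamma; get; FunEq; InOrbit; Nonzero)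
  open ≡-Reasoning

  d : ℕ
  d = suc d′

  module 𝕋 = Telescope T

  a : Vec Carrier d
  a = vecFrom d 𝕋.a

  u₀ : Vec Carrier M → Carrier
  u₀ u = sumR d (λ r → get a r * get u (2 ℕ.* r ℕ.+ 1))

  T≢0 : ∀ i → i ℕ.< M → T i ≢ 0#
  T≢0 = get-nonzero t t≢0

  T≢0′ : ∀ i → i ℕ.< suc (2 ℕ.* d′ ℕ.+ 1) → T i ≢ 0#
  T≢0′ i i<M = T≢0 i (subst (i ℕ.<_) (sym M≡) i<M)

  T-last≡0 : T (suc (2 ℕ.* d′ ℕ.+ 1)) ≡ 0#
  T-last≡0 = subst (λ m → T m ≡ 0#) M≡ T-M≡0

  odd<M : ∀ p → p ℕ.< d → 2 ℕ.* p ℕ.+ 1 ℕ.< M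
  odd<M p p<d = subst (2 ℕ.* p ℕ.+ 1 ℕ.<_) (sym M≡) (s≤s (ℕP.+-monoˡ-≤ 1 (ℕP.*-monoʳ-≤ 2 (ℕP.≤-pred p<d))))

  a-nonzero : All Nonzero a
  a-nonzero = vecFrom-nonzero d 𝕋.a (λ p p<d → 𝕋.a-nonzero p (λ i i<2p+2 → T≢0 i (ℕP.<-≤-trans i<2p+2 (odd<M p p<d))))

  telescope-complete : ∀ x → sumR d (λ p → 𝕋.a p * shift T x (suc (2 ℕ.* p ℕ.+ 1))) ≡ shift T x 0
  telescope-complete x = begin
      sumR d (λ p → 𝕋.a p * shift T x (suc (2 ℕ.* p ℕ.+ 1)))
    ≡⟨ 𝕋.telescope x d (λ p p<d → T≢0 _ (odd<M p p<d)) ⟩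
      shift T x 0 + 𝕋.α d * x (2 ℕ.* d ℕ.+ 1)
    ≡⟨ cong (λ v → shift T x 0 + v * x (2 ℕ.* d ℕ.+ 1)) (trans (cong (𝕋.a d′ *_) T-last≡0) (zeroʳ _)) ⟩
      shift T x 0 + 0# * x (2 ℕ.* d ℕ.+ 1)
    ≡⟨ trans (cong (shift T x 0 +_) (zeroˡ _)) (+-identityʳ _) ⟩
      shift T x 0 ∎

  u₀-weights : ∀ (V : ℕ → Carrier) → sumR d (λ r → get a r * V r) ≡ sumR d (λ p → 𝕋.a p * V p)
  u₀-weights V = sumR-cong d (λ r r<d → cong (_* V r) (get-vecFrom d 𝕋.a r r<d))

  orbit⇒bandForm : ∀ μ → InOrbit n (lamT j k t) μ → Σ[ u ∈ Vec Carrier M ] FunEq n μ (lamT j k t ⊕ uSum j (u₀ u) u)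
  orbit⇒bandForm μ (g , h , g-unitriangular , _ , hg≡1 , μ≡) = u , λ X X-strictUpper → ≡⇒≈ (begin
      ev n μ X
    ≡⟨ ≈⇒≡ (μ≡ X X-strictUpper) ⟩
      ev n (lamT j k t) (mul n (mul n h X) g)
    ≡⟨ ev-lamT-conj g h g-unitriangular hg≡1 X X-strictUpper ⟩
      bandSum X (shift T x)
    ≡⟨ bandSum-cong X (λ i i<1+M → sym (coeff≡shift i i<1+M)) ⟩
      bandSum X (coeff (u₀ u) u)
    ≡⟨ sym (ev-bandForm (u₀ u) u X) ⟩
      ev n (lamT j k t ⊕ uSum j (u₀ u) u) X ∎)
    where
    x = superdiagonal g
    u : Vec Carrier M
    u = vecFrom M (λ i → shift T x (suc i))
    coeff≡shift : ∀ i → i ℕ.< suc M → coeff (u₀ u) u i ≡ shift T x i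
    coeff≡shift zero _ =
      trans (u₀-weights (λ r → get u (2 ℕ.* r ℕ.+ 1)))
            (trans (sumR-cong d (λ p p<d → cong (𝕋.a p *_) (get-vecFrom M (λ i → shift T x (suc i)) _ (odd<M p p<d)))) (telescope-complete x))
    coeff≡shift (suc i) i<1+M = get-vecFrom M (λ i → shift T x (suc i)) i (ℕP.≤-pred i<1+M)

  bandForm⇒orbit : ∀ μ (u : Vec Carrier M) → FunEq n μ (lamT j k t ⊕ uSum j (u₀ u) u) → InOrbit n (lamT j k t) μ
  bandForm⇒orbit μ u μ≡ = bidiag , bidiagInv , bidiag-unitriangular , bidiag-rightInverse , bidiag-leftInverse , conj
    where
    U : ℕ → Carrier
    U = coeff (u₀ u) u
    open Solution T U
    open Bidiagonal F n (λ b → x (b ∸ j))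
    superdiagonal≡x : ∀ i → superdiagonal bidiag i ≡ x i
    superdiagonal≡x i = trans (bidiag-super (j ℕ.+ i)) (cong x (ℕP.m+n∸m≡n j i))
    shift≡U : ∀ i → i ℕ.< suc M → shift T x i ≡ U i
    shift≡U i i<1+M with i ℕ.≟ M
    ... | yes refl = subst (λ m → shift T x m ≡ U m) (sym M≡)
                       (lastEquation T x U d′ T≢0′ T-last≡0 (λ i i<M → shift-solution i (T≢0′ i i<M))
                                     (u₀-weights (λ r → get u (2 ℕ.* r ℕ.+ 1))))
    ... | no i≢M = shift-solution i (T≢0 i (ℕP.≤∧≢⇒< (ℕP.≤-pred i<1+M) i≢M))
    conj : ∀ X → IsStrictUpper n X → ev n μ X ≈ ev n (lamT j k t) (mul n (mul n bidiagInv X) bidiag)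
    conj X X-strictUpper = ≡⇒≈ (begin
        ev n μ X
      ≡⟨ ≈⇒≡ (μ≡ X X-strictUpper) ⟩
        ev n (lamT j k t ⊕ uSum j (u₀ u) u) X
      ≡⟨ ev-bandForm (u₀ u) u X ⟩
        bandSum X U
      ≡⟨ bandSum-cong X (λ i i<1+M → trans (sym (shift≡U i i<1+M)) (shift-cong T (λ i → sym (superdiagonal≡x i)) i)) ⟩
        bandSum X (shift T (superdiagonal bidiag))
      ≡⟨ sym (ev-lamT-conj bidiag bidiagInv bidiag-unitriangular bidiag-leftInverse X X-strictUpper) ⟩
        ev n (lamT j k t) (mul n (mul n bidiagInv X) bidiag) ∎)

  orbit-parametrisation :
    Σ[ a′ ∈ Vec Carrier d ] (All Nonzero a′ ×
      (∀ μ → InOrbit n (lamT j k t) μ ⇔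
             (Σ[ u ∈ Vec Carrier M ] FunEq n μ (lamT j k t ⊕ uSum j (sumR d (λ r → get a′ r * get u (2 ℕ.* r ℕ.+ 1))) u))))
  orbit-parametrisation = a , a-nonzero , λ μ → mk⇔ (orbit⇒bandForm μ) (λ (u , μ≡) → bandForm⇒orbit μ u μ≡)

  δ₀ : Carrier → ℕ → Carrier
  δ₀ u i = if i ≡ᵇ 0 then u else 0#

  bandSum-+-δ₀ : ∀ X w u → bandSum X w + u * Y X 0 ≡ bandSum X (λ i → w i + δ₀ u i)
  bandSum-+-δ₀ X w u = begin
      (Σz + sumR (suc M) (λ i → w i * Y X i)) + u * Y X 0
    ≡⟨ +-assoc Σz _ _ ⟩
      Σz + (sumR (suc M) (λ i → w i * Y X i) + u * Y X 0)
    ≡⟨ cong (λ v → Σz + (sumR (suc M) (λ i → w i * Y X i) + v)) (sym (sumR-single (suc M) 0 _ (s≤s z≤n) δ₀-off)) ⟩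
      Σz + (sumR (suc M) (λ i → w i * Y X i) + sumR (suc M) (λ i → δ₀ u i * Y X i))
    ≡⟨ cong (Σz +_) (sym (trans (sumR-cong (suc M) (λ i _ → *-distribʳ-+ (Y X i) (w i) (δ₀ u i))) (sumR-+ (suc M) _ _))) ⟩
      Σz + sumR (suc M) (λ i → (w i + δ₀ u i) * Y X i) ∎
    where
    Σz = sumR M (λ r → T r * Z X r)
    δ₀-off : ∀ i → i ℕ.< suc M → i ≢ 0 → δ₀ u i * Y X i ≡ 0#
    δ₀-off zero    _ 0≢0 = ⊥-elim (0≢0 refl)
    δ₀-off (suc i) _ _   = zeroˡ (Y X (suc i))

  orbit-bandCoordinates : ∀ u μ → InOrbit n (lamT j k t ⊕ (u · e* j (j ℕ.+ 1))) μ →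
    Σ[ x ∈ (ℕ → Carrier) ] (∀ i → i ℕ.< suc M → μ (j ℕ.+ i) (suc (j ℕ.+ i)) ≡ shift T x i + δ₀ u i)
  orbit-bandCoordinates u μ (g , h , g-unitriangular , _ , hg≡1 , μ≡) =
    superdiagonal g , bandCoordinate μ _ ev-μ
    where
    ev-μ : ∀ X → IsStrictUpper n X → ev n μ X ≡ bandSum X (λ i → shift T (superdiagonal g) i + δ₀ u i)
    ev-μ X X-strictUpper = begin
        ev n μ X
      ≡⟨ ≈⇒≡ (μ≡ X X-strictUpper) ⟩
        ev n (lamT j k t ⊕ (u · e* j (j ℕ.+ 1))) (mul n (mul n h X) g)
      ≡⟨ ev-⊕ n (lamT j k t) (u · e* j (j ℕ.+ 1)) (mul n (mul n h X) g) ⟩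
        ev n (lamT j k t) (mul n (mul n h X) g) + ev n (u · e* j (j ℕ.+ 1)) (mul n (mul n h X) g)
      ≡⟨ cong₂ _+_ (ev-lamT-conj g h g-unitriangular hg≡1 X X-strictUpper) (ev-e*₀-conj g h g-unitriangular hg≡1 X X-strictUpper u) ⟩
        bandSum X (shift T (superdiagonal g)) + u * Y X 0
      ≡⟨ bandSum-+-δ₀ X (shift T (superdiagonal g)) u ⟩
        bandSum X (λ i → shift T (superdiagonal g) i + δ₀ u i) ∎

  -- The telescoped combination of the band entries of μ, constant on each orbit.
  invariant : Fun → Carrier
  invariant μ = μ (j ℕ.+ 0) (suc (j ℕ.+ 0)) + - sumR d (λ p → 𝕋.a p * μ (j ℕ.+ suc (2 ℕ.* p ℕ.+ 1)) (suc (j ℕ.+ suc (2 ℕ.* p ℕ.+ 1))))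

  invariant-orbit : ∀ u μ → InOrbit n (lamT j k t ⊕ (u · e* j (j ℕ.+ 1))) μ → invariant μ ≡ u
  invariant-orbit u μ μ∈orbit = begin
      μ (j ℕ.+ 0) (suc (j ℕ.+ 0)) + - sumR d (λ p → 𝕋.a p * μ (j ℕ.+ odd p) (suc (j ℕ.+ odd p)))
    ≡⟨ cong₂ (λ v w → v + - w) (μ≡ 0 (s≤s z≤n)) (trans (sumR-cong d odd-entries) (telescope-complete x)) ⟩
      (shift T x 0 + u) + - shift T x 0
    ≡⟨ cong (_+ - shift T x 0) (+-comm (shift T x 0) u) ⟩
      (u + shift T x 0) + - shift T x 0
    ≡⟨ +-assoc u (shift T x 0) (- shift T x 0) ⟩
      u + (shift T x 0 + - shift T x 0)
    ≡⟨ trans (cong (u +_) (-‿inverseʳ (shift T x 0))) (+-identityʳ u) ⟩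
      u ∎
    where
    odd : ℕ → ℕ
    odd p = suc (2 ℕ.* p ℕ.+ 1)
    x = proj₁ (orbit-bandCoordinates u μ μ∈orbit)
    μ≡ = proj₂ (orbit-bandCoordinates u μ μ∈orbit)
    odd-entries : ∀ p → p ℕ.< d → 𝕋.a p * μ (j ℕ.+ odd p) (suc (j ℕ.+ odd p)) ≡ 𝕋.a p * shift T x (odd p)
    odd-entries p p<d = cong (𝕋.a p *_) (trans (μ≡ (odd p) (s≤s (odd<M p p<d))) (+-identityʳ (shift T x (odd p))))

  orbits-disjoint : ∀ u u′ μ → InOrbit n (lamT j k t ⊕ (u · e* j (j ℕ.+ 1))) μ →
                    InOrbit n (lamT j k t ⊕ (u′ · e* j (j ℕ.+ 1))) μ → u ≈ u′
  orbits-disjoint u u′ μ μ∈orbit μ∈orbit′ = ≡⇒≈ (trans (sym (invariant-orbit u μ μ∈orbit)) (invariant-orbit u′ μ μ∈orbit′))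

  -- λ_t + γ has band coordinates all equal to 1, so it lies in the orbit iff Σ a_p = 1, i.e. iff H vanishes.
  sum-a≡1⇒H≡0 : sumR d 𝕋.a ≡ 1# → H d T ≡ 0#
  sum-a≡1⇒H≡0 Σa≡1 = +-cancelˡ (sumR d 𝕋.a) _ _ (trans (sum-a+H≡1 d T) (sym (trans (+-identityʳ _) Σa≡1)))

  H≡0⇒sum-a≡1 : H d T ≡ 0# → sumR d 𝕋.a ≡ 1#
  H≡0⇒sum-a≡1 H≡0 = trans (sym (+-identityʳ _)) (trans (cong (sumR d 𝕋.a +_) (sym H≡0)) (sum-a+H≡1 d T))

  gamma-orbit⇒H≡0 : InOrbit n (lamT j k t) (lamT j k t ⊕ gamma j k) → H d T ≡ 0#
  gamma-orbit⇒H≡0 (g , h , g-unitriangular , _ , hg≡1 , μ≡) = sum-a≡1⇒H≡0 (begin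
      sumR d 𝕋.a
    ≡⟨ sumR-cong d (λ p p<d → trans (sym (*-identityʳ _)) (cong (𝕋.a p *_) (sym (shift≡1 _ (s≤s (odd<M p p<d)))))) ⟩
      sumR d (λ p → 𝕋.a p * shift T x (suc (2 ℕ.* p ℕ.+ 1)))
    ≡⟨ telescope-complete x ⟩
      shift T x 0
    ≡⟨ shift≡1 0 (s≤s z≤n) ⟩
      1# ∎)
    where
    x = superdiagonal g
    shift≡1 : ∀ i → i ℕ.< suc M → shift T x i ≡ 1#
    shift≡1 i i<1+M =
      trans (sym (bandCoordinate (lamT j k t ⊕ gamma j k) (shift T x)
                    (λ X X-strictUpper → trans (≈⇒≡ (μ≡ X X-strictUpper)) (ev-lamT-conj g h g-unitriangular hg≡1 X X-strictUpper)) i i<1+M))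
            (bandCoordinate (lamT j k t ⊕ gamma j k) (λ _ → 1#) (λ X _ → ev-lamT⊕gamma X) i i<1+M)

  H≡0⇒gamma-orbit : H d T ≡ 0# → InOrbit n (lamT j k t) (lamT j k t ⊕ gamma j k)
  H≡0⇒gamma-orbit H≡0 = bandForm⇒orbit (lamT j k t ⊕ gamma j k) ones λ X _ → ≡⇒≈ (begin
      ev n (lamT j k t ⊕ gamma j k) X
    ≡⟨ ev-lamT⊕gamma X ⟩
      bandSum X (λ _ → 1#)
    ≡⟨ bandSum-cong X (λ i i<1+M → sym (coeff≡1 i i<1+M)) ⟩
      bandSum X (coeff (u₀ ones) ones)
    ≡⟨ sym (ev-bandForm (u₀ ones) ones X) ⟩
      ev n (lamT j k t ⊕ uSum j (u₀ ones) ones) X ∎)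
    where
    ones : Vec Carrier M
    ones = vecFrom M (λ _ → 1#)
    coeff≡1 : ∀ i → i ℕ.< suc M → coeff (u₀ ones) ones i ≡ 1#
    coeff≡1 zero    _ = trans (u₀-weights (λ r → get ones (2 ℕ.* r ℕ.+ 1)))
      (trans (sumR-cong d (λ p p<d → trans (cong (𝕋.a p *_) (get-vecFrom M (λ _ → 1#) _ (odd<M p p<d))) (*-identityʳ _)))
             (H≡0⇒sum-a≡1 H≡0))
    coeff≡1 (suc i) i<1+M = get-vecFrom M (λ _ → 1#) i (ℕP.≤-pred i<1+M)

open import Data.Nat using (_≤_; _+_; _*_; _/_; _%_)
open import Data.Nat.DivMod using (m≡m%n+[m/n]*n; m*n/n≡m)
open import Data.Integer.Base using (+_)
open ClosedForm using (closedForm)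

oddLength : ∀ m → m % 2 ≡ 1 → Σ[ d′ ∈ ℕ ] (suc m / 2 ≡ suc d′) × (suc m ≡ suc (2 * d′ + 1))
oddLength m m%2≡1 =
  m / 2 , trans (cong (_/ 2) 1+m≡) (m*n/n≡m (suc (m / 2)) 2) , trans 1+m≡ (trans (ℕP.*-comm (suc (m / 2)) 2) (2*suc (m / 2)))
  where
  2*suc : ∀ p → 2 * suc p ≡ suc (2 * p + 1)
  2*suc p = trans (ℕP.*-suc 2 p) (cong suc (sym (ℕP.+-comm (2 * p) 1)))
  1+m≡ : suc m ≡ suc (m / 2) * 2
  1+m≡ = cong suc (trans (m≡m%n+[m/n]*n m 2) (cong (_+ m / 2 * 2) m%2≡1))

module Census {c ℓ} (F : FiniteField c ℓ) (n j k : ℕ) (1≤j : 1 ≤ j) (j≤k : j ≤ k) (k+2≤n : k + 2 ≤ n)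
    (d′ : ℕ) (M≡ : suc (k ∸ j) ≡ suc (2 * d′ + 1)) where
  open FieldFacts F using (Carrier; 0#; _≟_)
  open Recurrence F using (H)
  open Counting F
  open LinAlg F using (get; Nonzero; InOrbit; lamT; gamma; _⊕_)
  private module R = FiniteField F

  M d : ℕ
  M = suc (k ∸ j)
  d = suc d′

  H≡0? : ∀ (t : Vec Carrier M) → Dec (H d (get t) ≡ 0#)
  H≡0? t = H d (get t) ≟ 0#

  solutions : List (Vec Carrier M)
  solutions = filter H≡0? (unitVectors M)

  solutions-unique : Unique solutions
  solutions-unique = UniqueP.filter⁺ H≡0? (unitVectors-unique M)

  ∈-solutions⇔ : ∀ t → (t ∈ solutions) ⇔ (All Nonzero t × InOrbit n (lamT j k t) (lamT j k t ⊕ gamma j k))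
  ∈-solutions⇔ t = mk⇔ to from
    where
    to : t ∈ solutions → All Nonzero t × InOrbit n (lamT j k t) (lamT j k t ⊕ gamma j k)
    to t∈ with ∈P.∈-filter⁻ H≡0? {xs = unitVectors M} t∈
    ... | t∈unitVectors , H≡0 = t≢0 , Orbit.H≡0⇒gamma-orbit F n j k 1≤j j≤k k+2≤n t d′ M≡ t≢0 H≡0
      where t≢0 = ∈-unitVectors⁻ t t∈unitVectors
    from : All Nonzero t × InOrbit n (lamT j k t) (lamT j k t ⊕ gamma j k) → t ∈ solutions
    from (t≢0 , γ∈orbit) =
      ∈P.∈-filter⁺ H≡0? (∈-unitVectors⁺ t t≢0) (Orbit.gamma-orbit⇒H≡0 F n j k 1≤j j≤k k+2≤n t d′ M≡ t≢0 γ∈orbit)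

  length-solutions : length solutions ≡ #H-zero d
  length-solutions = trans (length-filter H≡0? (unitVectors M))
    (subst (λ m → sumL (unitVectors m) (λ t → indicator (HIsZero d t)) ≡ #H-zero d) (trans double-d≡ (sym M≡)) refl)
    where
    double-d≡ : double d ≡ suc (2 * d′ + 1)
    double-d≡ = trans (cong (λ v → suc (suc v)) (double≡2* d′)) (cong suc (sym (ℕP.+-comm (2 * d′) 1)))

  count-solutions : (+ R.q) ℤ.* (+ length solutions) ≡
                    ((+ R.q ℤ.- + 1) ℤ.^ (2 * d)) ℤ.- (-1ℤ ℤ.^ d) ℤ.* ((+ R.q ℤ.- + 1) ℤ.^ d)
  count-solutions rewrite length-solutions =
    subst (λ q → (+ q) ℤ.* (+ #H-zero d) ≡ ((+ q ℤ.- + 1) ℤ.^ (2 * d)) ℤ.- (-1ℤ ℤ.^ d) ℤ.* ((+ q ℤ.- + 1) ℤ.^ d))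
          (sym q≡1+#units)
          (subst (λ e → (+ suc #units) ℤ.* (+ #H-zero d) ≡ ((+ #units) ℤ.^ e) ℤ.- (-1ℤ ℤ.^ d) ℤ.* ((+ #units) ℤ.^ d))
                 (double≡2* d)
                 (closedForm #units #H-zero #H-nonzero #H-zero-0 #H-zero-suc #H-zero+#H-nonzero d))

lemma3p4 : ∀ {c ℓ} (F : FiniteField c ℓ) →
    let open LinAlg F
    in (n j k : ℕ) → 1 ≤ j → j ≤ k → k + 2 ≤ n → (k ∸ j) % 2 ≡ 1 →
       let d = suc (k ∸ j) / 2 in
       ((t : Vec Carrier (suc (k ∸ j))) → All Nonzero t →
          (Σ[ a ∈ Vec Carrier d ] (All Nonzero a ×
             (∀ μ → InOrbit n (lamT j k t) μ ⇔
                    (Σ[ u ∈ Vec Carrier (suc (k ∸ j)) ] FunEq n μ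
                       (lamT j k t ⊕ uSum j (sumR d (λ r → get a r *F get u (2 * r + 1))) u)))))
          ×
          (∀ (u u′ : Carrier) (μ : Fun) → InOrbit n (lamT j k t ⊕ (u · e* j (j + 1))) μ →
                      InOrbit n (lamT j k t ⊕ (u′ · e* j (j + 1))) μ → u ≈ u′))
       ×
       (Σ[ L ∈ List (Vec Carrier (suc (k ∸ j))) ] (Unique L ×
          (∀ (t : Vec Carrier (suc (k ∸ j))) →
             (t ∈ L) ⇔ (All Nonzero t × InOrbit n (lamT j k t) (lamT j k t ⊕ gamma j k))) ×
          (+ q) ℤ.* (+ length L) ≡
            ((+ q ℤ.- + 1) ℤ.^ (2 * d)) ℤ.- (-1ℤ ℤ.^ d) ℤ.* ((+ q ℤ.- + 1) ℤ.^ d)))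
lemma3p4 F n j k 1≤j j≤k k+2≤n k∸j-odd with oddLength (k ∸ j) k∸j-odd
... | d′ , d≡ , M≡ rewrite d≡ =
  (λ t t≢0 → let open Orbit F n j k 1≤j j≤k k+2≤n t d′ M≡ t≢0 in orbit-parametrisation , orbits-disjoint) ,
  (solutions , solutions-unique , ∈-solutions⇔ , count-solutions)
  where open Census F n j k 1≤j j≤k k+2≤n d′ M≡
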